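{- Let $q$ be a prime power, $m\ge2$ an integer, and $g(x)=x^m+\sum_{i=2}^{m-1}a_ix^i$ with $a_i\in\mathbb{F}_q$. If $g$ is a permutation polynomial of $\mathbb{F}_q$, then there are $q^2(q-1)$ linearized polynomials $L(x)$ over $\mathbb{F}_{q^2}$ of rank $1$ such that $g(x^q+x)+L(x)$ is a (normalized) permutation polynomial of $\mathbb{F}_{q^2}$.
   Context: A linearized polynomial over $\mathbb{F}_{q^2}$ is $L(x)=\alpha_1x^q+\alpha_0x$ with $\alpha_0,\alpha_1\in\mathbb{F}_{q^2}$; its rank is that of the $\mathbb{F}_q$-linear evaluation map on $\mathbb{F}_{q^2}$. A permutation polynomial of a finite field is one whose evaluation map is a bijection; "normalized" means monic and mapping $0$ to $0$. -}

module Defs where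

open import Level using (0ℓ)
open import Data.Nat as ℕ using (ℕ; zero; suc; _∸_)
open import Data.Nat.Primality using (Prime)
open import Data.Fin using (Fin)
import Data.Fin
import Data.Product
open import Data.Product using (Σ; ∃; _×_; _,_)
open import Relation.Binary.PropositionalEquality using (_≡_)
open import Relation.Nullary using (¬_)
open import Algebra.Bundles using (CommutativeRing)
open import Algebra.Morphism.Structures using (module RingMorphisms)

IsPrimePower : ℕ → Set
IsPrimePower q = Σ ℕ λ p → Σ ℕ λ k → Prime p × q ≡ p ℕ.^ suc k

record Field : Set₁ where
  field
    commRing : CommutativeRing 0ℓ 0ℓ
  open CommutativeRing commRing public
  field
    1≉0 : ¬ (1# ≈ 0#)
    inverse : ∀ x → ¬ (x ≈ 0#) → ∃ λ y → x * y ≈ 1#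

module _ (K : Field) where
  open Field K

  HasSize : ℕ → Set
  HasSize n = Σ (Fin n → Carrier) λ e →
    (∀ i j → e i ≈ e j → i ≡ j) × (∀ x → ∃ λ i → e i ≈ x)

  pow : Carrier → ℕ → Carrier
  pow x zero = 1#
  pow x (suc n) = x * pow x n

  sumFrom : (ℕ → Carrier) → ℕ → ℕ → Carrier
  sumFrom f lo zero = 0#
  sumFrom f lo (suc k) = f lo + sumFrom f (suc lo) k

  sumFin : (r : ℕ) → (Fin r → Carrier) → Carrier
  sumFin zero f = 0#
  sumFin (suc r) f = f Data.Fin.zero + sumFin r (λ j → f (Data.Fin.suc j))

  -- g(x) = x^m + Σ_{i=2}^{m-1} a_i x^i  (only a 2, ..., a (m-1) are used)
  evalG : ℕ → (ℕ → Carrier) → Carrier → Carrier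
  evalG m a x = pow x m + sumFrom (λ i → a i * pow x i) 2 (m ∸ 2)

  IsPermutation : (Carrier → Carrier) → Set
  IsPermutation f = (∀ x y → f x ≈ f y → x ≈ y) × (∀ y → ∃ λ x → f x ≈ y)

IsEmbedding : (F E : Field) → (Field.Carrier F → Field.Carrier E) → Set
IsEmbedding F E ι =
  RingMorphisms.IsRingMonomorphism (Field.rawRing F) (Field.rawRing E) ι

module _ (F E : Field) (ι : Field.Carrier F → Field.Carrier E) where
  private
    module F = Field F
  open Field E

  linEval : ℕ → Carrier → Carrier → Carrier → Carrier
  linEval q α₁ α₀ x = α₁ * pow E x q + α₀ * x

  HasRank : (Carrier → Carrier) → ℕ → Set
  HasRank L r = Σ (Fin r → Carrier) λ b →
      (∀ j → ∃ λ x → L x ≈ b j)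
    × (∀ x → ∃ λ (c : Fin r → F.Carrier) → L x ≈ sumFin E r (λ j → ι (c j) * b j))
    × (∀ (c : Fin r → F.Carrier) → sumFin E r (λ j → ι (c j) * b j) ≈ 0#
         → ∀ j → c j F.≈ F.0#)

  CountPairs : (Carrier → Carrier → Set) → ℕ → Set
  CountPairs P n = Σ (Fin n → Carrier × Carrier) λ e →
      (∀ i → P (Data.Product.proj₁ (e i)) (Data.Product.proj₂ (e i)))
    × (∀ i j → Data.Product.proj₁ (e i) ≈ Data.Product.proj₁ (e j)
             → Data.Product.proj₂ (e i) ≈ Data.Product.proj₂ (e j) → i ≡ j)
    × (∀ α₁ α₀ → P α₁ α₀ → ∃ λ i →
         (Data.Product.proj₁ (e i) ≈ α₁) × (Data.Product.proj₂ (e i) ≈ α₀))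

{-# OPTIONS --safe #-}
-- Let φ x = x^q be the Frobenius of E = F_{q²} over F = F_q and Tr x = φ x + x the trace, so the
-- polynomial in question is x ↦ g (Tr x) + L x.  Fix θ ∈ E ∖ F.  For u, c ∈ F and d ∈ F* put
-- γ = u + θ, β = c + d θ and L x = β Tr (γ x), i.e. α₁ = β φ γ, α₀ = β γ.  In the basis 1, θ the
-- polynomial becomes x ↦ (g s + c t , d t) with s = Tr x, t = Tr (γ x): a bijection, since g is
-- one and x ↦ (Tr x , Tr (γ x)) is injective when γ ∉ F.  Conversely, if L has rank one and the
-- polynomial permutes E, then a kernel vector w ≠ 0 and the trace-zero element η = θ - φ θ give
-- γ = η / w with α₀ φ γ = α₁ γ; β = α₀ / γ cannot lie in F (all values would lie in F), and
-- scaling the θ-coordinate of γ to 1 recovers a unique triple (u, c, d): q · q · (q - 1) in all.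
module Submission where

open import Level using (0ℓ)
open import Algebra.Bundles using (CommutativeRing)
open import Algebra.Morphism.Structures using (module RingMorphisms)
open import Data.Empty using (⊥; ⊥-elim)
open import Data.Fin as Fin using (Fin; punchIn; punchOut; remQuot; combine)
import Data.Fin.Properties as FinP
open import Data.Fin.Permutation using (Permutation; permutation)
open import Data.Integer as ℤ using (ℤ; +_; -[1+_]; sign; ∣_∣; _◃_)
import Data.Integer.Properties as ℤP
open import Data.Maybe using (Maybe; just; nothing)
open import Data.Nat as ℕ using (ℕ; zero; suc; _!; _∸_; _≤_; _<_; z≤n; s≤s; NonZero)
import Data.Nat.Properties as ℕP
open import Data.Nat.Combinatorics using (_C_; nCn≡1; nCk≡n!/k![n-k]!; k![n∸k]!∣n!)
open import Data.Nat.DivMod using (m/n*n≡m)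
open import Data.Nat.Divisibility using (_∣_; _∤_; divides; ∣⇒≤; ∣1⇒≡1; m∣m*n)
open import Data.Nat.Primality using (Prime; euclidsLemma; ¬prime[0]; ¬prime[1])
open import Data.Product using (∃; ∃₂; _×_; _,_; proj₁; proj₂)
open import Data.Sign as Sign using (Sign)
open import Data.Sum using (inj₁; inj₂)
open import Data.Vec using (Vec; []; _∷_)
open import Function using (_∘_)
open import Function.Definitions using (Injective)
open import Relation.Binary.Definitions using (Decidable)
open import Relation.Binary.PropositionalEquality as ≡ using (_≡_)
open import Relation.Nullary using (¬_; yes; no)
open import Relation.Nullary.Decidable using (¬?)
open import Relation.Nullary.Negation using (contradiction)
open import Defs

module ℤ-Solver (R : CommutativeRing 0ℓ 0ℓ) where
  open CommutativeRing R hiding (zero)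
  open import Algebra.Properties.Semiring.Mult.TCOptimised semiring renaming (_×_ to _·_) using (×-homo-+; ×1-homo-*)
  open import Algebra.Properties.Ring ring using (-‿distribˡ-*; -‿distribʳ-*)
  open import Algebra.Properties.AbelianGroup +-abelianGroup using (⁻¹-involutive; ⁻¹-∙-comm; ε⁻¹≈ε)
  open import Algebra.Solver.Ring.AlmostCommutativeRing
  open import Relation.Binary.Reasoning.Setoid setoid

  fromℤ : ℤ → Carrier
  fromℤ (+ n) = n · 1#
  fromℤ -[1+ n ] = - (suc n · 1#)

  signed : Sign → Carrier → Carrier
  signed Sign.+ x = x
  signed Sign.- x = - x

  signed-cong : ∀ s {x y} → x ≈ y → signed s x ≈ signed s y
  signed-cong Sign.+ x≈y = x≈y
  signed-cong Sign.- x≈y = -‿cong x≈y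

  signed-* : ∀ s t x y → signed (s Sign.* t) (x * y) ≈ signed s x * signed t y
  signed-* Sign.- Sign.- x y = trans (sym (⁻¹-involutive _)) (trans (-‿cong (-‿distribˡ-* x y)) (-‿distribʳ-* (- x) y))
  signed-* Sign.- Sign.+ x y = -‿distribˡ-* x y
  signed-* Sign.+ Sign.- x y = -‿distribʳ-* x y
  signed-* Sign.+ Sign.+ x y = refl

  fromℤ-◃ : ∀ s n → fromℤ (s ◃ n) ≈ signed s (n · 1#)
  fromℤ-◃ Sign.+ zero = refl
  fromℤ-◃ Sign.- zero = sym ε⁻¹≈ε
  fromℤ-◃ Sign.+ (suc n) = refl
  fromℤ-◃ Sign.- (suc n) = refl

  fromℤ-signAbs : ∀ i → fromℤ i ≈ signed (sign i) (∣ i ∣ · 1#)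
  fromℤ-signAbs i = trans (reflexive (≡.cong fromℤ (≡.sym (ℤP.◃-inverse i)))) (fromℤ-◃ (sign i) ∣ i ∣)

  fromℤ-neg : ∀ i → fromℤ (ℤ.- i) ≈ - fromℤ i
  fromℤ-neg -[1+ n ] = sym (⁻¹-involutive _)
  fromℤ-neg (+ zero) = sym ε⁻¹≈ε
  fromℤ-neg (+ suc n) = refl

  fromℤ-⊖ : ∀ m n → fromℤ (m ℤ.⊖ n) ≈ m · 1# - n · 1#
  fromℤ-⊖ zero zero = sym (-‿inverseʳ 0#)
  fromℤ-⊖ zero (suc n) = sym (+-identityˡ _)
  fromℤ-⊖ (suc m) zero = trans (sym (+-identityʳ _)) (+-congˡ (sym ε⁻¹≈ε))
  fromℤ-⊖ (suc m) (suc n) = begin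
    fromℤ (suc m ℤ.⊖ suc n)        ≡⟨ ≡.cong fromℤ (ℤP.[1+m]⊖[1+n]≡m⊖n m n) ⟩
    fromℤ (m ℤ.⊖ n)                ≈⟨ fromℤ-⊖ m n ⟩
    m · 1# - n · 1#                ≈⟨ add-1#-both (m · 1#) (n · 1#) ⟩
    (1# + m · 1#) - (1# + n · 1#)  ≈⟨ +-cong (sym (×-homo-+ 1# 1 m)) (-‿cong (sym (×-homo-+ 1# 1 n))) ⟩
    suc m · 1# - suc n · 1#        ∎
    where
    add-1#-both : ∀ a b → a - b ≈ (1# + a) - (1# + b)
    add-1#-both a b = begin
      a - b                  ≈⟨ sym (+-identityˡ _) ⟩
      0# + (a - b)           ≈⟨ +-congʳ (sym (-‿inverseʳ 1#)) ⟩
      (1# - 1#) + (a - b)    ≈⟨ +-assoc 1# (- 1#) (a - b) ⟩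
      1# + (- 1# + (a - b))  ≈⟨ +-congˡ (sym (+-assoc (- 1#) a (- b))) ⟩
      1# + ((- 1# + a) - b)  ≈⟨ +-congˡ (+-congʳ (+-comm (- 1#) a)) ⟩
      1# + ((a - 1#) - b)    ≈⟨ +-congˡ (+-assoc a (- 1#) (- b)) ⟩
      1# + (a + (- 1# - b))  ≈⟨ sym (+-assoc 1# a _) ⟩
      (1# + a) + (- 1# - b)  ≈⟨ +-congˡ (⁻¹-∙-comm 1# b) ⟩
      (1# + a) - (1# + b)    ∎

  fromℤ-+ : ∀ i j → fromℤ (i ℤ.+ j) ≈ fromℤ i + fromℤ j
  fromℤ-+ -[1+ m ] -[1+ n ] = begin
    - (suc (suc (m ℕ.+ n)) · 1#)   ≡⟨ ≡.cong (λ k → - (k · 1#)) (≡.sym (ℕP.+-suc (suc m) n)) ⟩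
    - ((suc m ℕ.+ suc n) · 1#)     ≈⟨ -‿cong (×-homo-+ 1# (suc m) (suc n)) ⟩
    - (suc m · 1# + suc n · 1#)    ≈⟨ sym (⁻¹-∙-comm _ _) ⟩
    - (suc m · 1#) - (suc n · 1#)  ∎
  fromℤ-+ -[1+ m ] (+ n) = trans (fromℤ-⊖ n (suc m)) (+-comm _ _)
  fromℤ-+ (+ m) -[1+ n ] = fromℤ-⊖ m (suc n)
  fromℤ-+ (+ m) (+ n) = ×-homo-+ 1# m n

  fromℤ-* : ∀ i j → fromℤ (i ℤ.* j) ≈ fromℤ i * fromℤ j
  fromℤ-* i j = begin
    fromℤ (i ℤ.* j)                                        ≈⟨ fromℤ-◃ (sign i Sign.* sign j) (∣ i ∣ ℕ.* ∣ j ∣) ⟩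
    signed (sign i Sign.* sign j) ((∣ i ∣ ℕ.* ∣ j ∣) · 1#)    ≈⟨ signed-cong (sign i Sign.* sign j) (×1-homo-* ∣ i ∣ ∣ j ∣) ⟩
    signed (sign i Sign.* sign j) ((∣ i ∣ · 1#) * (∣ j ∣ · 1#)) ≈⟨ signed-* (sign i) (sign j) _ _ ⟩
    signed (sign i) (∣ i ∣ · 1#) * signed (sign j) (∣ j ∣ · 1#) ≈⟨ *-cong (sym (fromℤ-signAbs i)) (sym (fromℤ-signAbs j)) ⟩
    fromℤ i * fromℤ j                                        ∎

  fromℤ-morphism : CommutativeRing.rawRing ℤP.+-*-commutativeRing -Raw-AlmostCommutative⟶ fromCommutativeRing R
  fromℤ-morphism = record
    { ⟦_⟧ = fromℤ ; +-homo = fromℤ-+ ; *-homo = fromℤ-* ; -‿homo = fromℤ-neg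
    ; 0-homo = refl ; 1-homo = refl }

  fromℤ-≈? : ∀ i j → Maybe (fromℤ i ≈ fromℤ j)
  fromℤ-≈? i j with i ℤ.≟ j
  ... | yes ≡.refl = just refl
  ... | no _ = nothing

  open import Algebra.Solver.Ring (CommutativeRing.rawRing ℤP.+-*-commutativeRing) (fromCommutativeRing R) fromℤ-morphism fromℤ-≈? public

-- Finite sets and binomial coefficients
Fin-injective⇒surjective : ∀ {n} (f : Fin n → Fin n) → Injective _≡_ _≡_ f → ∀ y → ∃ λ x → f x ≡ y
Fin-injective⇒surjective {suc n} f f-inj y with FinP.any? (λ x → f x Fin.≟ y)
... | yes found = found
... | no ¬found = ⊥-elim (FinP.<⇒notInjective (ℕP.n<1+n n) g-inj)
  where
  g : Fin (suc n) → Fin n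
  g x = punchOut {i = y} {j = f x} (λ eq → ¬found (x , ≡.sym eq))
  g-inj : Injective _≡_ _≡_ g
  g-inj {i} {j} eq = f-inj (FinP.punchOut-injective (λ e → ¬found (i , ≡.sym e)) (λ e → ¬found (j , ≡.sym e)) eq)

injective⇒permutation : ∀ {n} (f : Fin n → Fin n) → Injective _≡_ _≡_ f → Permutation n n
injective⇒permutation f f-inj = permutation f (λ y → proj₁ (onto y)) (λ y → proj₂ (onto y))
  (λ x → f-inj (proj₂ (onto (f x))))
  where
  onto : ∀ y → ∃ λ x → f x ≡ y
  onto = Fin-injective⇒surjective f f-inj

prime∤! : ∀ {p} → Prime p → ∀ {j} → j < p → p ∤ j !
prime∤! pr {zero} _ p∣1 = ¬prime[1] (≡.subst Prime (∣1⇒≡1 p∣1) pr)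
prime∤! pr {suc j} j<p p∣j! with euclidsLemma (suc j) (j !) pr p∣j!
... | inj₁ p∣1+j = ℕP.<⇒≱ j<p (∣⇒≤ p∣1+j)
... | inj₂ p∣j! = prime∤! pr (ℕP.<-trans (ℕP.n<1+n j) j<p) p∣j!

prime∣C : ∀ {p} → Prime p → ∀ {k} → 0 < k → k < p → p ∣ p C k
prime∣C {zero} pr = contradiction pr ¬prime[0]
prime∣C {suc p′} pr {k} 0<k k<p
  with euclidsLemma (p C k) (k ! ℕ.* (p ∸ k) !) pr p∣C*k![p∸k]!
  where
  p = suc p′
  instance
    k!*[p∸k]!≢0 : NonZero (k ! ℕ.* (p ∸ k) !)
    k!*[p∸k]!≢0 = k ℕP.!* (p ∸ k) !≢0
  p∣C*k![p∸k]! : p ∣ (p C k) ℕ.* (k ! ℕ.* (p ∸ k) !)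
  p∣C*k![p∸k]! = ≡.subst (p ∣_)
    (≡.sym (≡.trans (≡.cong (ℕ._* (k ! ℕ.* (p ∸ k) !)) (nCk≡n!/k![n-k]! (ℕP.<⇒≤ k<p))) (m/n*n≡m (k![n∸k]!∣n! (ℕP.<⇒≤ k<p)))))
    (m∣m*n (p′ !))
... | inj₁ p∣C = p∣C
... | inj₂ p∣k!*[p∸k]! with euclidsLemma (k !) ((suc p′ ∸ k) !) pr p∣k!*[p∸k]!
...   | inj₁ p∣k! = contradiction p∣k! (prime∤! pr k<p)
...   | inj₂ p∣[p∸k]! = contradiction p∣[p∸k]! (prime∤! pr (ℕP.∸-monoʳ-< 0<k (ℕP.<⇒≤ k<p)))

prime⇒2+ : ∀ {p} → Prime p → ∃ λ r → p ≡ suc (suc r)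
prime⇒2+ {zero} pr = contradiction pr ¬prime[0]
prime⇒2+ {suc zero} pr = contradiction pr ¬prime[1]
prime⇒2+ {suc (suc r)} _ = r , ≡.refl

remQuot-injective : ∀ {m} n {i j : Fin (m ℕ.* n)} →
  proj₁ (remQuot {m} n i) ≡ proj₁ (remQuot {m} n j) → proj₂ (remQuot {m} n i) ≡ proj₂ (remQuot {m} n j) → i ≡ j
remQuot-injective {m} n {i} {j} eq₁ eq₂ =
  ≡.trans (≡.sym (FinP.combine-remQuot {m} n i)) (≡.trans (≡.cong₂ combine eq₁ eq₂) (FinP.combine-remQuot {m} n j))

module FieldProperties (K : Field) where
  open Field K hiding (zero)
  open ℤ-Solver commRing using (solve; _:=_; _:+_; _:-_; _:*_)
  open import Relation.Binary.Reasoning.Setoid setoid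

  inv : ∀ x → x ≉ 0# → Carrier
  inv x x≉0 = proj₁ (inverse x x≉0)

  inv-inverseʳ : ∀ x (x≉0 : x ≉ 0#) → x * inv x x≉0 ≈ 1#
  inv-inverseʳ x x≉0 = proj₂ (inverse x x≉0)

  inv-inverseˡ : ∀ x (x≉0 : x ≉ 0#) → inv x x≉0 * x ≈ 1#
  inv-inverseˡ x x≉0 = trans (*-comm _ _) (inv-inverseʳ x x≉0)

  *-cancelˡ : ∀ {x y z} → x ≉ 0# → x * y ≈ x * z → y ≈ z
  *-cancelˡ {x} {y} {z} x≉0 xy≈xz = begin
    y                    ≈⟨ sym (*-identityˡ y) ⟩
    1# * y               ≈⟨ *-congʳ (sym (inv-inverseˡ x x≉0)) ⟩
    (inv x x≉0 * x) * y  ≈⟨ *-assoc _ _ _ ⟩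
    inv x x≉0 * (x * y)  ≈⟨ *-congˡ xy≈xz ⟩
    inv x x≉0 * (x * z)  ≈⟨ sym (*-assoc _ _ _) ⟩
    (inv x x≉0 * x) * z  ≈⟨ *-congʳ (inv-inverseˡ x x≉0) ⟩
    1# * z               ≈⟨ *-identityˡ z ⟩
    z                    ∎

  *-cancelʳ : ∀ {x y z} → x ≉ 0# → y * x ≈ z * x → y ≈ z
  *-cancelʳ {x} {y} {z} x≉0 yx≈zx = *-cancelˡ x≉0 (trans (*-comm x y) (trans yx≈zx (*-comm z x)))

  x*y≈0⇒y≈0 : ∀ {x y} → x ≉ 0# → x * y ≈ 0# → y ≈ 0#
  x*y≈0⇒y≈0 {x} x≉0 xy≈0 = *-cancelˡ x≉0 (trans xy≈0 (sym (zeroʳ x)))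

  *-≉0 : ∀ {x y} → x ≉ 0# → y ≉ 0# → x * y ≉ 0#
  *-≉0 x≉0 y≉0 xy≈0 = y≉0 (x*y≈0⇒y≈0 x≉0 xy≈0)

  inv-≉0 : ∀ x (x≉0 : x ≉ 0#) → inv x x≉0 ≉ 0#
  inv-≉0 x x≉0 x⁻¹≈0 = 1≉0 (trans (sym (inv-inverseʳ x x≉0)) (trans (*-congˡ x⁻¹≈0) (zeroʳ x)))

  x-y≈0⇒x≈y : ∀ {x y} → x - y ≈ 0# → x ≈ y
  x-y≈0⇒x≈y {x} {y} x-y≈0 = begin
    x              ≈⟨ solve 2 (λ x y → x := (x :- y) :+ y) refl x y ⟩
    (x - y) + y    ≈⟨ +-congʳ x-y≈0 ⟩
    0# + y         ≈⟨ +-identityˡ y ⟩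
    y              ∎

  x≈y⇒x-y≈0 : ∀ {x y} → x ≈ y → x - y ≈ 0#
  x≈y⇒x-y≈0 {x} {y} x≈y = trans (+-congʳ x≈y) (-‿inverseʳ y)

  +-cancelʳ : ∀ {x y z w} → x + z ≈ y + w → z ≈ w → x ≈ y
  +-cancelʳ {x} {y} {z} {w} x+z≈y+w z≈w = begin
    x              ≈⟨ solve 2 (λ x z → x := (x :+ z) :- z) refl x z ⟩
    (x + z) - z    ≈⟨ +-cong x+z≈y+w (-‿cong z≈w) ⟩
    (y + w) - w    ≈⟨ solve 2 (λ y w → (y :+ w) :- w := y) refl y w ⟩
    y              ∎


  pow-cong : ∀ {x y} n → x ≈ y → pow K x n ≈ pow K y n
  pow-cong zero x≈y = refl
  pow-cong (suc n) x≈y = *-cong x≈y (pow-cong n x≈y)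

  pow-+ : ∀ x m n → pow K x (m ℕ.+ n) ≈ pow K x m * pow K x n
  pow-+ x zero n = sym (*-identityˡ _)
  pow-+ x (suc m) n = trans (*-congˡ (pow-+ x m n)) (sym (*-assoc _ _ _))

  pow-* : ∀ x m n → pow K x (m ℕ.* n) ≈ pow K (pow K x m) n
  pow-* x m zero = reflexive (≡.cong (pow K x) (ℕP.*-zeroʳ m))
  pow-* x m (suc n) = begin
    pow K x (m ℕ.* suc n)              ≡⟨ ≡.cong (pow K x) (ℕP.*-suc m n) ⟩
    pow K x (m ℕ.+ m ℕ.* n)            ≈⟨ pow-+ x m (m ℕ.* n) ⟩
    pow K x m * pow K x (m ℕ.* n)      ≈⟨ *-congˡ (pow-* x m n) ⟩
    pow K x m * pow K (pow K x m) n    ∎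

  pow-distrib-* : ∀ x y n → pow K (x * y) n ≈ pow K x n * pow K y n
  pow-distrib-* x y zero = sym (*-identityˡ _)
  pow-distrib-* x y (suc n) = trans (*-congˡ (pow-distrib-* x y n))
    (solve 4 (λ x y a b → (x :* y) :* (a :* b) := (x :* a) :* (y :* b)) refl x y (pow K x n) (pow K y n))

  pow-1# : ∀ n → pow K 1# n ≈ 1#
  pow-1# zero = refl
  pow-1# (suc n) = trans (*-identityˡ _) (pow-1# n)

  pow-≉0 : ∀ {x} n → x ≉ 0# → pow K x n ≉ 0#
  pow-≉0 zero x≉0 = 1≉0
  pow-≉0 (suc n) x≉0 = *-≉0 x≉0 (pow-≉0 n x≉0)

  sumFrom-cong : ∀ {f f′} lo n → (∀ i → f i ≈ f′ i) → sumFrom K f lo n ≈ sumFrom K f′ lo n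
  sumFrom-cong lo zero _ = refl
  sumFrom-cong lo (suc n) f≈f′ = +-cong (f≈f′ lo) (sumFrom-cong (suc lo) n f≈f′)

  evalG-cong : ∀ m b {x y} → x ≈ y → evalG K m b x ≈ evalG K m b y
  evalG-cong m b x≈y = +-cong (pow-cong m x≈y)
    (sumFrom-cong 2 (m ∸ 2) (λ i → *-congˡ (pow-cong i x≈y)))

  size≥2 : ∀ {n} → HasSize K n → ∃ λ r → n ≡ suc (suc r)
  size≥2 {zero} (_ , _ , onto) with proj₁ (onto 0#)
  ... | ()
  size≥2 {suc zero} (element , _ , onto) = contradiction (begin
      1#                          ≈⟨ sym (proj₂ (onto 1#)) ⟩
      element (proj₁ (onto 1#))   ≡⟨ ≡.cong element (Fin1-unique _ _) ⟩
      element (proj₁ (onto 0#))   ≈⟨ proj₂ (onto 0#) ⟩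
      0#                          ∎) 1≉0
    where
    Fin1-unique : (i j : Fin 1) → i ≡ j
    Fin1-unique Fin.zero Fin.zero = ≡.refl
  size≥2 {suc (suc r)} _ = r , ≡.refl

module FiniteField (K : Field) {m : ℕ} (size : HasSize K (suc m)) where
  open Field K hiding (zero)
  open FieldProperties K
  open ℤ-Solver commRing using (solve; _:=_; _:+_; _:-_; _:*_)
  open import Algebra.Properties.Semiring.Mult semiring renaming (_×_ to _·_) using ()
  import Algebra.Properties.CommutativeMonoid.Sum as MonoidSum
  module Σ+ = MonoidSum +-commutativeMonoid
  module Π* = MonoidSum *-commutativeMonoid
  open import Relation.Binary.Reasoning.Setoid setoid

  n : ℕ
  n = suc m

  element : Fin n → Carrier
  element = proj₁ size

  element-injective : ∀ i j → element i ≈ element j → i ≡ j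
  element-injective = proj₁ (proj₂ size)

  index : Carrier → Fin n
  index x = proj₁ (proj₂ (proj₂ size) x)

  element-index : ∀ x → element (index x) ≈ x
  element-index x = proj₂ (proj₂ (proj₂ size) x)

  index-cong : ∀ {x y} → x ≈ y → index x ≡ index y
  index-cong {x} {y} x≈y = element-injective _ _ (trans (element-index x) (trans x≈y (sym (element-index y))))

  index-injective : ∀ {x y} → index x ≡ index y → x ≈ y
  index-injective {x} {y} eq = trans (sym (element-index x)) (trans (reflexive (≡.cong element eq)) (element-index y))

  _≟_ : Decidable _≈_
  x ≟ y with index x Fin.≟ index y
  ... | yes eq = yes (index-injective eq)
  ... | no ¬eq = no (¬eq ∘ index-cong)

  enumeration-injective⇒surjective : (f : Fin n → Carrier) → (∀ i j → f i ≈ f j → i ≡ j) → ∀ x → ∃ λ i → f i ≈ x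
  enumeration-injective⇒surjective f f-inj x
    with Fin-injective⇒surjective (index ∘ f) (λ eq → f-inj _ _ (index-injective eq)) (index x)
  ... | i , eq = i , index-injective eq

  injective⇒surjective : (f : Carrier → Carrier) → (∀ x y → f x ≈ f y → x ≈ y) → ∀ y → ∃ λ x → f x ≈ y
  injective⇒surjective f f-inj y
    with enumeration-injective⇒surjective (f ∘ element) (λ i j fi≈fj → element-injective i j (f-inj _ _ fi≈fj)) y
  ... | i , fi≈y = element i , fi≈y

  -- Translation by x permutes K, so Σ K = Σ K + n · x.
  n·x≈0 : ∀ x → n · x ≈ 0#
  n·x≈0 x = sym (a≈a+b⇒0≈b translated-sum)
    where
    a≈a+b⇒0≈b : ∀ {a b} → a ≈ a + b → 0# ≈ b
    a≈a+b⇒0≈b {a} {b} a≈a+b = begin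
      0#           ≈⟨ sym (-‿inverseʳ a) ⟩
      a - a        ≈⟨ +-congʳ a≈a+b ⟩
      (a + b) - a  ≈⟨ solve 2 (λ a b → (a :+ b) :- a := b) refl a b ⟩
      b            ∎
    translate : Fin n → Fin n
    translate i = index (element i + x)
    translate-injective : Injective _≡_ _≡_ translate
    translate-injective eq = element-injective _ _ (+-cancelʳ (index-injective eq) refl)
    translated-sum : Σ+.sum element ≈ Σ+.sum element + n · x
    translated-sum = begin
      Σ+.sum element                             ≈⟨ Σ+.sum-permute element (injective⇒permutation translate translate-injective) ⟩
      Σ+.sum (element ∘ translate)               ≈⟨ Σ+.sum-cong-≋ (λ i → element-index (element i + x)) ⟩
      Σ+.sum (λ i → element i + x)               ≈⟨ Σ+.∑-distrib-+ element (λ _ → x) ⟩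
      Σ+.sum element + Σ+.sum {n} (λ _ → x)      ≈⟨ +-congˡ (Σ+.sum-replicate n) ⟩
      Σ+.sum element + n · x                     ∎

  product-≉0 : ∀ {k} (f : Fin k → Carrier) → (∀ i → f i ≉ 0#) → Π*.sum f ≉ 0#
  product-≉0 {zero} f f≉0 = 1≉0
  product-≉0 {suc k} f f≉0 = *-≉0 (f≉0 Fin.zero) (product-≉0 (f ∘ Fin.suc) (f≉0 ∘ Fin.suc))

  product-scale : ∀ {k} x (f : Fin k → Carrier) → Π*.sum (λ i → x * f i) ≈ pow K x k * Π*.sum f
  product-scale {zero} x f = sym (*-identityˡ _)
  product-scale {suc k} x f = begin
    (x * f Fin.zero) * Π*.sum (λ i → x * f (Fin.suc i))      ≈⟨ *-congˡ (product-scale x (f ∘ Fin.suc)) ⟩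
    (x * f Fin.zero) * (pow K x k * Π*.sum (f ∘ Fin.suc))    ≈⟨ solve 4 (λ x a b c → (x :* a) :* (b :* c) := (x :* b) :* (a :* c)) refl x (f Fin.zero) (pow K x k) _ ⟩
    (x * pow K x k) * (f Fin.zero * Π*.sum (f ∘ Fin.suc))    ∎

  zeroIndex : Fin n
  zeroIndex = index 0#

  nonzeroElement : Fin m → Carrier
  nonzeroElement j = element (punchIn zeroIndex j)

  nonzeroElement-≉0 : ∀ j → nonzeroElement j ≉ 0#
  nonzeroElement-≉0 j e = FinP.punchInᵢ≢i zeroIndex j (element-injective _ _ (trans e (sym (element-index 0#))))

  nonzeroElement-injective : ∀ i j → nonzeroElement i ≈ nonzeroElement j → i ≡ j
  nonzeroElement-injective i j e = FinP.punchIn-injective zeroIndex i j (element-injective _ _ e)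

  nonzeroIndex : ∀ x → x ≉ 0# → Fin m
  nonzeroIndex x x≉0 = punchOut {i = zeroIndex} {j = index x} (λ eq → x≉0 (sym (index-injective eq)))

  nonzeroElement-nonzeroIndex : ∀ x (x≉0 : x ≉ 0#) → nonzeroElement (nonzeroIndex x x≉0) ≈ x
  nonzeroElement-nonzeroIndex x x≉0 = trans (reflexive (≡.cong element (FinP.punchIn-punchOut _))) (element-index x)

  -- Multiplication by x permutes the nonzero elements, so Π K* = x^m Π K*.
  fermat-≉0 : ∀ x → x ≉ 0# → pow K x m ≈ 1#
  fermat-≉0 x x≉0 = *-cancelʳ (product-≉0 nonzeroElement nonzeroElement-≉0) (trans (sym scaled-product) (sym (*-identityˡ _)))
    where
    scale : Fin m → Fin m
    scale j = nonzeroIndex (x * nonzeroElement j) (*-≉0 x≉0 (nonzeroElement-≉0 j))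
    nonzeroElement-scale : ∀ j → nonzeroElement (scale j) ≈ x * nonzeroElement j
    nonzeroElement-scale j = nonzeroElement-nonzeroIndex _ (*-≉0 x≉0 (nonzeroElement-≉0 j))
    scale-injective : Injective _≡_ _≡_ scale
    scale-injective {i} {j} eq = nonzeroElement-injective i j (*-cancelˡ x≉0
      (trans (sym (nonzeroElement-scale i)) (trans (reflexive (≡.cong nonzeroElement eq)) (nonzeroElement-scale j))))
    scaled-product : Π*.sum nonzeroElement ≈ pow K x m * Π*.sum nonzeroElement
    scaled-product = begin
      Π*.sum nonzeroElement                  ≈⟨ Π*.sum-permute nonzeroElement (injective⇒permutation scale scale-injective) ⟩
      Π*.sum (nonzeroElement ∘ scale)        ≈⟨ Π*.sum-cong-≋ nonzeroElement-scale ⟩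
      Π*.sum (λ j → x * nonzeroElement j)    ≈⟨ product-scale x nonzeroElement ⟩
      pow K x m * Π*.sum nonzeroElement      ∎

  fermat : ∀ x → pow K x n ≈ x
  fermat x with x ≟ 0#
  ... | yes x≈0 = trans (*-congʳ x≈0) (trans (zeroˡ _) (sym x≈0))
  ... | no x≉0 = trans (*-congˡ (fermat-≉0 x x≉0)) (*-identityʳ x)

module Frobenius (K : Field) {p : ℕ} (p-prime : Prime p) where
  open Field K hiding (zero)
  open FieldProperties K
  open import Relation.Binary.Reasoning.Setoid setoid
  open import Algebra.Properties.Semiring.Mult semiring renaming (_×_ to _·_) using (×-congʳ; ×-assoc-*; ×-assocˡ)
  open import Algebra.Properties.Semiring.Exp semiring using (_^_)
  open import Algebra.Properties.CommutativeSemiring.Binomial commutativeSemiring using (theorem; binomialExpansion; binomialTerm)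
  open import Algebra.Properties.Semiring.Sum semiring using (sum; sum-init-last; sum-replicate-zero; sum-cong-≋)
  open import Data.Vec.Functional using (Vector)

  pow≈^ : ∀ x n → pow K x n ≈ x ^ n
  pow≈^ x zero = refl
  pow≈^ x (suc n) = *-congˡ (pow≈^ x n)

  n·0#≈0# : ∀ n → n · 0# ≈ 0#
  n·0#≈0# zero = refl
  n·0#≈0# (suc n) = trans (+-identityˡ _) (n·0#≈0# n)

  sum-endpoints : ∀ {r} (t : Vector Carrier (suc (suc r))) → (∀ j → t (Fin.suc (Fin.inject₁ j)) ≈ 0#) →
                  sum t ≈ t Fin.zero + t (Fin.fromℕ (suc r))
  sum-endpoints {r} t interior≈0 = +-congˡ (begin
    sum (t ∘ Fin.suc)                                           ≈⟨ sum-init-last (t ∘ Fin.suc) ⟩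
    sum (λ j → t (Fin.suc (Fin.inject₁ j))) + t (Fin.fromℕ (suc r)) ≈⟨ +-congʳ (trans (sum-cong-≋ interior≈0) (sum-replicate-zero r)) ⟩
    0# + t (Fin.fromℕ (suc r))                                   ≈⟨ +-identityˡ _ ⟩
    t (Fin.fromℕ (suc r))                                        ∎)

  module _ (p·1≈0 : p · 1# ≈ 0#) where
    p∣m⇒m·x≈0 : ∀ {m} x → p ∣ m → m · x ≈ 0#
    p∣m⇒m·x≈0 x (divides c ≡.refl) = begin
      (c ℕ.* p) · x      ≈⟨ sym (×-assocˡ x c p) ⟩
      c · (p · x)        ≈⟨ ×-congʳ c p·x≈0 ⟩
      c · 0#             ≈⟨ n·0#≈0# c ⟩
      0#                 ∎
      where
      p·x≈0 : p · x ≈ 0#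
      p·x≈0 = begin
        p · x            ≈⟨ ×-congʳ p (sym (*-identityˡ x)) ⟩
        p · (1# * x)     ≈⟨ sym (×-assoc-* p 1# x) ⟩
        (p · 1#) * x     ≈⟨ *-congʳ p·1≈0 ⟩
        0# * x           ≈⟨ zeroˡ x ⟩
        0#               ∎

    -- Only the two extreme terms of the binomial expansion survive: p divides the others.
    pow-p-+ : ∀ x y → pow K (x + y) p ≈ pow K x p + pow K y p
    pow-p-+ x y with prime⇒2+ p-prime
    ... | r , ≡.refl = begin
      pow K (x + y) p                                             ≈⟨ pow≈^ (x + y) p ⟩
      (x + y) ^ p                                                 ≈⟨ theorem p x y ⟩
      binomialExpansion x y p                                     ≈⟨ sum-endpoints (binomialTerm x y p) interior≈0 ⟩
      binomialTerm x y p Fin.zero + binomialTerm x y p (Fin.fromℕ p)  ≈⟨ +-comm _ _ ⟩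
      binomialTerm x y p (Fin.fromℕ p) + binomialTerm x y p Fin.zero  ≈⟨ +-cong last≈x^p first≈y^p ⟩
      pow K x p + pow K y p                                      ∎
      where
      interior≈0 : ∀ j → binomialTerm x y p (Fin.suc (Fin.inject₁ j)) ≈ 0#
      interior≈0 j = p∣m⇒m·x≈0 _ (prime∣C p-prime (s≤s z≤n) (s≤s (≡.subst (ℕ._< suc r) (≡.sym (FinP.toℕ-inject₁ j)) (FinP.toℕ<n j))))
      first≈y^p : binomialTerm x y p Fin.zero ≈ pow K y p
      first≈y^p = trans (+-identityʳ _) (trans (*-identityˡ _) (sym (pow≈^ y p)))
      last≈x^p : binomialTerm x y p (Fin.fromℕ p) ≈ pow K x p
      last≈x^p = begin
        (p C Fin.toℕ (Fin.fromℕ p)) · (x ^ Fin.toℕ (Fin.fromℕ p) * y ^ (p ∸ Fin.toℕ (Fin.fromℕ p)))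
          ≡⟨ ≡.cong (λ k → (p C k) · (x ^ k * y ^ (p ∸ k))) (FinP.toℕ-fromℕ p) ⟩
        (p C p) · (x ^ p * y ^ (p ∸ p))  ≡⟨ ≡.cong₂ (λ c e → c · (x ^ p * y ^ e)) (nCn≡1 p) (ℕP.n∸n≡0 p) ⟩
        1 · (x ^ p * 1#)                      ≈⟨ trans (+-identityʳ _) (*-identityʳ _) ⟩
        x ^ p                                 ≈⟨ sym (pow≈^ x p) ⟩
        pow K x p                             ∎

    pow-p^-+ : ∀ j x y → pow K (x + y) (p ℕ.^ j) ≈ pow K x (p ℕ.^ j) + pow K y (p ℕ.^ j)
    pow-p^-+ zero x y = trans (*-identityʳ _) (+-cong (sym (*-identityʳ x)) (sym (*-identityʳ y)))
    pow-p^-+ (suc j) x y = begin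
      pow K (x + y) (p ℕ.* p ℕ.^ j)                               ≈⟨ pow-* (x + y) p (p ℕ.^ j) ⟩
      pow K (pow K (x + y) p) (p ℕ.^ j)                           ≈⟨ pow-cong (p ℕ.^ j) (pow-p-+ x y) ⟩
      pow K (pow K x p + pow K y p) (p ℕ.^ j)                     ≈⟨ pow-p^-+ j _ _ ⟩
      pow K (pow K x p) (p ℕ.^ j) + pow K (pow K y p) (p ℕ.^ j)   ≈⟨ +-cong (sym (pow-* x p (p ℕ.^ j))) (sym (pow-* y p (p ℕ.^ j))) ⟩
      pow K x (p ℕ.* p ℕ.^ j) + pow K y (p ℕ.* p ℕ.^ j)           ∎

module RootBound (K : Field) where
  open Field K hiding (zero)
  open FieldProperties K
  open ℤ-Solver commRing using (solve; _:=_; _:+_; _:-_; _:*_; :-_; con)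
  open import Relation.Binary.Reasoning.Setoid setoid

  eval : ∀ {d} → Vec Carrier d → Carrier → Carrier
  eval [] x = 0#
  eval (c ∷ cs) x = c + x * eval cs x

  leading : ∀ {d} → Vec Carrier (suc d) → Carrier
  leading (c ∷ []) = c
  leading (c ∷ c′ ∷ cs) = leading (c′ ∷ cs)

  divideByLinear : ∀ {d} → Vec Carrier (suc d) → Carrier → Vec Carrier d × Carrier
  divideByLinear (c ∷ []) r = [] , c
  divideByLinear (c ∷ c′ ∷ cs) r =
    (proj₂ (divideByLinear (c′ ∷ cs) r) ∷ proj₁ (divideByLinear (c′ ∷ cs) r)) , c + r * proj₂ (divideByLinear (c′ ∷ cs) r)

  quotient : ∀ {d} → Vec Carrier (suc d) → Carrier → Vec Carrier d
  quotient cs r = proj₁ (divideByLinear cs r)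

  remainder : ∀ {d} → Vec Carrier (suc d) → Carrier → Carrier
  remainder cs r = proj₂ (divideByLinear cs r)

  eval-divideByLinear : ∀ {d} (cs : Vec Carrier (suc d)) r x → eval cs x ≈ (x - r) * eval (quotient cs r) x + remainder cs r
  eval-divideByLinear (c ∷ []) r x = solve 3 (λ c r x → c :+ x :* con (ℤ.+ 0) := (x :- r) :* con (ℤ.+ 0) :+ c) refl c r x
  eval-divideByLinear (c ∷ c′ ∷ cs) r x = begin
    c + x * eval (c′ ∷ cs) x        ≈⟨ +-congˡ (*-congˡ (eval-divideByLinear (c′ ∷ cs) r x)) ⟩
    c + x * ((x - r) * Q + R)       ≈⟨ solve 5 (λ c x r Q R → c :+ x :* ((x :- r) :* Q :+ R) := (x :- r) :* (R :+ x :* Q) :+ (c :+ r :* R)) refl c x r Q R ⟩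
    (x - r) * (R + x * Q) + (c + r * R) ∎
    where
    Q = eval (quotient (c′ ∷ cs) r) x
    R = remainder (c′ ∷ cs) r

  leading-quotient : ∀ {d} (cs : Vec Carrier (suc (suc d))) r → leading (quotient cs r) ≡ leading cs
  leading-quotient (c ∷ c′ ∷ []) r = ≡.refl
  leading-quotient (c ∷ c′ ∷ c″ ∷ cs) r = leading-quotient (c′ ∷ c″ ∷ cs) r

  root⇒remainder≈0 : ∀ {d} (cs : Vec Carrier (suc d)) r → eval cs r ≈ 0# → remainder cs r ≈ 0#
  root⇒remainder≈0 cs r root = begin
    remainder cs r                                    ≈⟨ solve 2 (λ Q R → R := con (ℤ.+ 0) :* Q :+ R) refl (eval (quotient cs r) r) (remainder cs r) ⟩
    0# * eval (quotient cs r) r + remainder cs r       ≈⟨ +-congʳ (*-congʳ (sym (-‿inverseʳ r))) ⟩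
    (r - r) * eval (quotient cs r) r + remainder cs r  ≈⟨ sym (eval-divideByLinear cs r r) ⟩
    eval cs r                                         ≈⟨ root ⟩
    0#                                                ∎

  roots-bound : ∀ d (cs : Vec Carrier (suc d)) → leading cs ≉ 0# → (roots : Fin (suc d) → Carrier) →
                (∀ i j → roots i ≈ roots j → i ≡ j) → (∀ i → eval cs (roots i) ≈ 0#) → ⊥
  roots-bound zero (c ∷ []) c≉0 roots _ root = c≉0 (trans (sym (trans (+-congˡ (zeroʳ _)) (+-identityʳ c))) (root Fin.zero))
  roots-bound (suc d) cs lead≉0 roots roots-inj root =
    roots-bound d (quotient cs r) (λ e → lead≉0 (trans (reflexive (≡.sym (leading-quotient cs r))) e))
      (roots ∘ Fin.suc) (λ i j e → FinP.suc-injective (roots-inj _ _ e)) quotient-root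
    where
    r = roots Fin.zero
    quotient-root : ∀ j → eval (quotient cs r) (roots (Fin.suc j)) ≈ 0#
    quotient-root j = x*y≈0⇒y≈0 x-r≉0 (begin
      (x - r) * eval (quotient cs r) x                    ≈⟨ sym (+-identityʳ _) ⟩
      (x - r) * eval (quotient cs r) x + 0#               ≈⟨ +-congˡ (sym (root⇒remainder≈0 cs r (root Fin.zero))) ⟩
      (x - r) * eval (quotient cs r) x + remainder cs r   ≈⟨ sym (eval-divideByLinear cs r x) ⟩
      eval cs x                                           ≈⟨ root (Fin.suc j) ⟩
      0#                                                  ∎)
      where
      x = roots (Fin.suc j)
      x-r≉0 : x - r ≉ 0#
      x-r≉0 e with roots-inj _ _ (x-y≈0⇒x≈y e)
      ... | ()

  monomial : ∀ k → Vec Carrier (suc k)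
  monomial zero = 1# ∷ []
  monomial (suc k) = 0# ∷ monomial k

  eval-monomial : ∀ k x → eval (monomial k) x ≈ pow K x k
  eval-monomial zero x = trans (+-congˡ (zeroʳ x)) (+-identityʳ 1#)
  eval-monomial (suc k) x = trans (+-identityˡ _) (*-congˡ (eval-monomial k x))

  leading-∷-monomial : ∀ c k → leading (c ∷ monomial k) ≡ 1#
  leading-∷-monomial c zero = ≡.refl
  leading-∷-monomial c (suc k) = leading-∷-monomial 0# k

  pow-fixedPoints-bound : ∀ r → (roots : Fin (suc (suc (suc r))) → Carrier) → (∀ i j → roots i ≈ roots j → i ≡ j) →
                          (∀ i → pow K (roots i) (suc (suc r)) ≈ roots i) → ⊥
  pow-fixedPoints-bound r roots roots-inj fixed =
    roots-bound (suc (suc r)) (0# ∷ - 1# ∷ monomial r)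
      (λ e → 1≉0 (trans (reflexive (≡.sym (leading-∷-monomial (- 1#) r))) e)) roots roots-inj root
    where
    root : ∀ i → eval (0# ∷ - 1# ∷ monomial r) (roots i) ≈ 0#
    root i = begin
      0# + x * (- 1# + x * eval (monomial r) x) ≈⟨ +-congˡ (*-congˡ (+-congˡ (*-congˡ (eval-monomial r x)))) ⟩
      0# + x * (- 1# + x * pow K x r)         ≈⟨ solve 2 (λ x y → con (ℤ.+ 0) :+ x :* (:- con (ℤ.+ 1) :+ x :* y) := x :* (x :* y) :- x) refl x (pow K x r) ⟩
      pow K x (suc (suc r)) - x               ≈⟨ x≈y⇒x-y≈0 (fixed i) ⟩
      0#                                      ∎
      where x = roots i

module Embedding (F E : Field) (ι : Field.Carrier F → Field.Carrier E) (ι-embedding : IsEmbedding F E ι) where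
  private module F = Field F
  open Field E hiding (zero)
  open FieldProperties E using (sumFrom-cong)
  open RingMorphisms.IsRingMonomorphism ι-embedding public
    using () renaming (⟦⟧-cong to ι-cong; +-homo to ι-+; *-homo to ι-*; 1#-homo to ι-1#; 0#-homo to ι-0#; -‿homo to ι-neg; injective to ι-injective)

  ι-- : ∀ a b → ι (a F.- b) ≈ ι a - ι b
  ι-- a b = trans (ι-+ a (F.- b)) (+-congˡ (ι-neg b))

  ι-pow : ∀ a n → ι (pow F a n) ≈ pow E (ι a) n
  ι-pow a zero = ι-1#
  ι-pow a (suc n) = trans (ι-* a _) (*-congˡ (ι-pow a n))

  ι-sumFrom : ∀ (f : ℕ → F.Carrier) lo n → ι (sumFrom F f lo n) ≈ sumFrom E (ι ∘ f) lo n
  ι-sumFrom f lo zero = ι-0#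
  ι-sumFrom f lo (suc n) = trans (ι-+ _ _) (+-congˡ (ι-sumFrom f (suc lo) n))

  ι-evalG : ∀ m a s → ι (evalG F m a s) ≈ evalG E m (ι ∘ a) (ι s)
  ι-evalG m a s = begin
    ι (evalG F m a s)                                                           ≈⟨ ι-+ _ _ ⟩
    ι (pow F s m) + ι (sumFrom F (λ i → a i F.* pow F s i) 2 (m ∸ 2))           ≈⟨ +-cong (ι-pow s m) (ι-sumFrom _ 2 (m ∸ 2)) ⟩
    pow E (ι s) m + sumFrom E (λ i → ι (a i F.* pow F s i)) 2 (m ∸ 2)           ≈⟨ +-congˡ (sumFrom-cong 2 (m ∸ 2) (λ i → trans (ι-* _ _) (*-congˡ (ι-pow s i)))) ⟩
    evalG E m (ι ∘ a) (ι s)                                                     ∎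
    where open import Relation.Binary.Reasoning.Setoid setoid

-- The quadratic extension F_q ⊆ F_{q²}
module QuadraticExtension
  {r p k : ℕ} (p-prime : Prime p) (q≡p^k : suc (suc r) ≡ p ℕ.^ suc k)
  (F E : Field) (sizeF : HasSize F (suc (suc r))) (sizeE : HasSize E (suc (suc r) ℕ.* suc (suc r)))
  (ι : Field.Carrier F → Field.Carrier E) (ι-embedding : IsEmbedding F E ι) where

  q : ℕ
  q = suc (suc r)

  module F = Field F
  module FF = FieldProperties F
  module Fq = FiniteField F sizeF
  module Fq² = FiniteField E sizeE
  open Field E hiding (zero)
  open FieldProperties E
  open Embedding F E ι ι-embedding public
  open ℤ-Solver commRing using (solve; _:=_; _:+_; _:-_; _:*_; :-_; con)
  open import Relation.Binary.Reasoning.Setoid setoid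
  open import Algebra.Properties.Semiring.Mult semiring renaming (_×_ to _·_) using (×1-homo-*)

  p^j·1≈[p·1]^j : ∀ j → (p ℕ.^ j) · 1# ≈ pow E (p · 1#) j
  p^j·1≈[p·1]^j zero = +-identityʳ 1#
  p^j·1≈[p·1]^j (suc j) = trans (×1-homo-* p (p ℕ.^ j)) (*-congˡ (p^j·1≈[p·1]^j j))

  -- q² · 1 = 0 in E, and q² is a power of p.
  p·1≈0 : p · 1# ≈ 0#
  p·1≈0 with (p · 1#) Fq².≟ 0#
  ... | yes p·1≈0 = p·1≈0
  ... | no p·1≉0 = contradiction q²·1≈0 (*-≉0 (pow-≉0 (suc k) p·1≉0) (pow-≉0 (suc k) p·1≉0))
    where
    q²·1≈0 : pow E (p · 1#) (suc k) * pow E (p · 1#) (suc k) ≈ 0#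
    q²·1≈0 = begin
      pow E (p · 1#) (suc k) * pow E (p · 1#) (suc k)        ≈⟨ *-cong (sym (p^j·1≈[p·1]^j (suc k))) (sym (p^j·1≈[p·1]^j (suc k))) ⟩
      ((p ℕ.^ suc k) · 1#) * ((p ℕ.^ suc k) · 1#)            ≈⟨ sym (×1-homo-* (p ℕ.^ suc k) (p ℕ.^ suc k)) ⟩
      ((p ℕ.^ suc k) ℕ.* (p ℕ.^ suc k)) · 1#                 ≡⟨ ≡.cong (λ t → (t ℕ.* t) · 1#) (≡.sym q≡p^k) ⟩
      (q ℕ.* q) · 1#                                         ≈⟨ Fq².n·x≈0 1# ⟩
      0#                                                     ∎

  φ : Carrier → Carrier
  φ x = pow E x q

  φ-cong : ∀ {x y} → x ≈ y → φ x ≈ φ y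
  φ-cong = pow-cong q

  φ-+ : ∀ x y → φ (x + y) ≈ φ x + φ y
  φ-+ x y = ≡.subst (λ t → pow E (x + y) t ≈ pow E x t + pow E y t) (≡.sym q≡p^k)
    (Frobenius.pow-p^-+ E p-prime p·1≈0 (suc k) x y)

  φ-* : ∀ x y → φ (x * y) ≈ φ x * φ y
  φ-* x y = pow-distrib-* x y q

  φ-0# : φ 0# ≈ 0#
  φ-0# = zeroˡ _

  φ-1# : φ 1# ≈ 1#
  φ-1# = pow-1# q

  φ-neg : ∀ x → φ (- x) ≈ - φ x
  φ-neg x = begin
    φ (- x)                  ≈⟨ solve 2 (λ a b → b := (a :+ b) :- a) refl (φ x) (φ (- x)) ⟩
    (φ x + φ (- x)) - φ x    ≈⟨ +-congʳ (sym (φ-+ x (- x))) ⟩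
    φ (x - x) - φ x          ≈⟨ +-congʳ (trans (φ-cong (-‿inverseʳ x)) φ-0#) ⟩
    0# - φ x                 ≈⟨ +-identityˡ _ ⟩
    - φ x                    ∎

  φ-- : ∀ x y → φ (x - y) ≈ φ x - φ y
  φ-- x y = trans (φ-+ x (- y)) (+-congˡ (φ-neg y))

  φ-involutive : ∀ x → φ (φ x) ≈ x
  φ-involutive x = trans (sym (pow-* x q q)) (Fq².fermat x)

  φ-ι : ∀ a → φ (ι a) ≈ ι a
  φ-ι a = trans (sym (ι-pow a q)) (ι-cong (Fq.fermat a))

  φ-≉0 : ∀ {x} → x ≉ 0# → φ x ≉ 0#
  φ-≉0 = pow-≉0 q

  ι≈⇒φ-fixed : ∀ {a x} → ι a ≈ x → φ x ≈ x
  ι≈⇒φ-fixed {a} ιa≈x = trans (φ-cong (sym ιa≈x)) (trans (φ-ι a) ιa≈x)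

  -- The q elements of ι F and y would be q + 1 roots of x^q - x.
  φ-fixed⇒ι : ∀ y → φ y ≈ y → ∃ λ a → ι a ≈ y
  φ-fixed⇒ι y φy≈y with FinP.any? (λ i → ι (Fq.element i) Fq².≟ y)
  ... | yes (i , e) = Fq.element i , e
  ... | no y∉ = ⊥-elim (RootBound.pow-fixedPoints-bound E r roots roots-injective roots-fixed)
    where
    roots : Fin (suc q) → Carrier
    roots Fin.zero = y
    roots (Fin.suc i) = ι (Fq.element i)
    roots-injective : ∀ i j → roots i ≈ roots j → i ≡ j
    roots-injective Fin.zero Fin.zero e = ≡.refl
    roots-injective Fin.zero (Fin.suc j) e = ⊥-elim (y∉ (j , sym e))
    roots-injective (Fin.suc i) Fin.zero e = ⊥-elim (y∉ (i , e))
    roots-injective (Fin.suc i) (Fin.suc j) e = ≡.cong Fin.suc (Fq.element-injective i j (ι-injective e))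
    roots-fixed : ∀ i → φ (roots i) ≈ roots i
    roots-fixed Fin.zero = φy≈y
    roots-fixed (Fin.suc i) = φ-ι (Fq.element i)

  Tr : Carrier → Carrier
  Tr x = φ x + x

  Tr-cong : ∀ {x y} → x ≈ y → Tr x ≈ Tr y
  Tr-cong x≈y = +-cong (φ-cong x≈y) x≈y

  Tr-- : ∀ x y → Tr (x - y) ≈ Tr x - Tr y
  Tr-- x y = trans (+-congʳ (φ-- x y)) (solve 4 (λ a b x y → (a :- b) :+ (x :- y) := (a :+ x) :- (b :+ y)) refl (φ x) (φ y) x y)

  Tr-ι-* : ∀ a x → Tr (ι a * x) ≈ ι a * Tr x
  Tr-ι-* a x = trans (+-congʳ (trans (φ-* (ι a) x) (*-congʳ (φ-ι a)))) (sym (distribˡ (ι a) (φ x) x))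

  Tr-0# : Tr 0# ≈ 0#
  Tr-0# = trans (+-identityʳ _) φ-0#

  Tr∈ι : ∀ x → ∃ λ a → ι a ≈ Tr x
  Tr∈ι x = φ-fixed⇒ι (Tr x) (trans (φ-+ (φ x) x) (trans (+-congʳ (φ-involutive x)) (+-comm x (φ x))))

  tr : Carrier → F.Carrier
  tr x = proj₁ (Tr∈ι x)

  ι-tr : ∀ x → ι (tr x) ≈ Tr x
  ι-tr x = proj₂ (Tr∈ι x)

  tr≈⇒Tr≈ : ∀ {x y} → tr x F.≈ tr y → Tr x ≈ Tr y
  tr≈⇒Tr≈ {x} {y} e = trans (sym (ι-tr x)) (trans (ι-cong e) (ι-tr y))

  q<q*q : q < q ℕ.* q
  q<q*q = ℕP.m<m*n q q (s≤s (s≤s z≤n))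

  ∃∉ι : ∃ λ θ → ∀ a → ι a ≉ θ
  ∃∉ι with FinP.any? (λ j → ¬? (FinP.any? (λ i → ι (Fq.element i) Fq².≟ Fq².element j)))
  ... | yes (j , j∉) = Fq².element j , λ a e → j∉ (Fq.index a , trans (ι-cong (Fq.element-index a)) e)
  ... | no ¬∃∉ = ⊥-elim (FinP.<⇒notInjective q<q*q preimage-injective)
    where
    preimage : ∀ j → ∃ λ i → ι (Fq.element i) ≈ Fq².element j
    preimage j with FinP.any? (λ i → ι (Fq.element i) Fq².≟ Fq².element j)
    ... | yes found = found
    ... | no none = ⊥-elim (¬∃∉ (j , none))
    preimage-injective : Injective _≡_ _≡_ (proj₁ ∘ preimage)
    preimage-injective {i} {j} e = Fq².element-injective i j
      (trans (sym (proj₂ (preimage i))) (trans (reflexive (≡.cong (ι ∘ Fq.element) e)) (proj₂ (preimage j))))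

  θ : Carrier
  θ = proj₁ ∃∉ι

  ι≉θ : ∀ a → ι a ≉ θ
  ι≉θ = proj₂ ∃∉ι

  φ-fixed⇒≉θ : ∀ {x} → φ x ≈ x → x ≉ θ
  φ-fixed⇒≉θ {x} φx≈x x≈θ = ι≉θ _ (trans (proj₂ (φ-fixed⇒ι x φx≈x)) x≈θ)

  φθ≉θ : φ θ ≉ θ
  φθ≉θ φθ≈θ = φ-fixed⇒≉θ φθ≈θ refl

  ι-divide : ∀ {d y x} (d≉0 : ¬ (d F.≈ F.0#)) → ι d * x ≈ ι y → ι (FF.inv d d≉0 F.* y) ≈ x
  ι-divide {d} {y} {x} d≉0 dx≈y = begin
    ι (FF.inv d d≉0 F.* y)          ≈⟨ ι-* _ _ ⟩
    ι (FF.inv d d≉0) * ι y          ≈⟨ *-congˡ (sym dx≈y) ⟩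
    ι (FF.inv d d≉0) * (ι d * x)    ≈⟨ sym (*-assoc _ _ _) ⟩
    (ι (FF.inv d d≉0) * ι d) * x    ≈⟨ *-congʳ (trans (sym (ι-* _ _)) (trans (ι-cong (FF.inv-inverseˡ d d≉0)) ι-1#)) ⟩
    1# * x                          ≈⟨ *-identityˡ x ⟩
    x                               ∎

  ⟨_,_⟩ : F.Carrier → F.Carrier → Carrier
  ⟨ a , b ⟩ = ι a + ι b * θ

  ⟨,⟩-cong : ∀ {a a′ b b′} → a F.≈ a′ → b F.≈ b′ → ⟨ a , b ⟩ ≈ ⟨ a′ , b′ ⟩
  ⟨,⟩-cong a≈a′ b≈b′ = +-cong (ι-cong a≈a′) (*-congʳ (ι-cong b≈b′))

  ⟨a,0⟩≈ιa : ∀ {a b} → b F.≈ F.0# → ⟨ a , b ⟩ ≈ ι a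
  ⟨a,0⟩≈ιa b≈0 = trans (+-congˡ (trans (*-congʳ (trans (ι-cong b≈0) ι-0#)) (zeroˡ θ))) (+-identityʳ _)

  ⟨,⟩-injective : ∀ {a b a′ b′} → ⟨ a , b ⟩ ≈ ⟨ a′ , b′ ⟩ → a F.≈ a′ × b F.≈ b′
  ⟨,⟩-injective {a} {b} {a′} {b′} e with (b F.- b′) Fq.≟ F.0#
  ... | yes b-b′≈0 = ι-injective (+-cancelʳ e (*-congʳ (ι-cong b≈b′))) , b≈b′
    where
    b≈b′ : b F.≈ b′
    b≈b′ = FF.x-y≈0⇒x≈y b-b′≈0
  ... | no b-b′≉0 = ⊥-elim (ι≉θ _ (ι-divide b-b′≉0 (begin
    ι (b F.- b′) * θ                ≈⟨ *-congʳ (ι-- b b′) ⟩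
    (ι b - ι b′) * θ                ≈⟨ solve 3 (λ x y t → (x :- y) :* t := x :* t :- y :* t) refl (ι b) (ι b′) θ ⟩
    ι b * θ - ι b′ * θ              ≈⟨ solve 4 (λ a a′ t t′ → t :- t′ := (a :+ t) :- (a :+ t′)) refl (ι a) (ι a′) (ι b * θ) (ι b′ * θ) ⟩
    ⟨ a , b ⟩ - (ι a + ι b′ * θ)    ≈⟨ +-congʳ e ⟩
    ⟨ a′ , b′ ⟩ - (ι a + ι b′ * θ)  ≈⟨ solve 3 (λ a a′ t′ → (a′ :+ t′) :- (a :+ t′) := a′ :- a) refl (ι a) (ι a′) (ι b′ * θ) ⟩
    ι a′ - ι a                      ≈⟨ sym (ι-- a′ a) ⟩
    ι (a′ F.- a)                    ∎)))

  coordinates : ∀ z → ∃ λ a → ∃ λ b → ⟨ a , b ⟩ ≈ z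
  coordinates z = coordinate₁ i , coordinate₂ i , proj₂ onto
    where
    coordinate₁ coordinate₂ : Fin (q ℕ.* q) → F.Carrier
    coordinate₁ i = Fq.element (proj₁ (remQuot {q} q i))
    coordinate₂ i = Fq.element (proj₂ (remQuot {q} q i))
    pairs-injective : ∀ i j → ⟨ coordinate₁ i , coordinate₂ i ⟩ ≈ ⟨ coordinate₁ j , coordinate₂ j ⟩ → i ≡ j
    pairs-injective i j e = remQuot-injective {q} q
      (Fq.element-injective _ _ (proj₁ (⟨,⟩-injective e))) (Fq.element-injective _ _ (proj₂ (⟨,⟩-injective e)))
    onto : ∃ λ i → ⟨ coordinate₁ i , coordinate₂ i ⟩ ≈ z
    onto = Fq².enumeration-injective⇒surjective (λ i → ⟨ coordinate₁ i , coordinate₂ i ⟩) pairs-injective z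
    i = proj₁ onto

  η : Carrier
  η = θ - φ θ

  η≉0 : η ≉ 0#
  η≉0 η≈0 = φθ≉θ (sym (x-y≈0⇒x≈y η≈0))

  φη≈-η : φ η ≈ - η
  φη≈-η = begin
    φ (θ - φ θ)         ≈⟨ φ-- θ (φ θ) ⟩
    φ θ - φ (φ θ)       ≈⟨ +-congˡ (-‿cong (φ-involutive θ)) ⟩
    φ θ - θ             ≈⟨ solve 2 (λ t u → u :- t := :- (t :- u)) refl θ (φ θ) ⟩
    - (θ - φ θ)         ∎

  Tr-η : Tr η ≈ 0#
  Tr-η = trans (+-congʳ φη≈-η) (-‿inverseˡ η)

  -- Tr 1 = 2, and if 2 = 0 then Tr θ = θ + φ θ ≠ 0.
  ∃Tr≉0 : ∃ λ w → Tr w ≉ 0#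
  ∃Tr≉0 with Tr 1# Fq².≟ 0#
  ... | no Tr1≉0 = 1# , Tr1≉0
  ... | yes Tr1≈0 = θ , λ Trθ≈0 → φθ≉θ (begin
    φ θ                        ≈⟨ solve 2 (λ a t → a := (a :+ t) :- t) refl (φ θ) θ ⟩
    Tr θ - θ                   ≈⟨ +-congʳ Trθ≈0 ⟩
    0# - θ                     ≈⟨ solve 1 (λ t → con (ℤ.+ 0) :- t := :- t :+ con (ℤ.+ 0) :* t) refl θ ⟩
    - θ + 0# * θ               ≈⟨ +-congˡ (*-congʳ (sym (trans (+-congʳ (sym φ-1#)) Tr1≈0))) ⟩
    - θ + (1# + 1#) * θ        ≈⟨ solve 1 (λ t → :- t :+ (con (ℤ.+ 1) :+ con (ℤ.+ 1)) :* t := t) refl θ ⟩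
    θ                          ∎)

  ∃Tr≈1 : ∃ λ w → Tr w ≈ 1#
  ∃Tr≈1 = ι (FF.inv t t≉0) * w , (begin
    Tr (ι (FF.inv t t≉0) * w)        ≈⟨ Tr-ι-* _ w ⟩
    ι (FF.inv t t≉0) * Tr w          ≈⟨ *-congˡ (sym (ι-tr w)) ⟩
    ι (FF.inv t t≉0) * ι t           ≈⟨ sym (ι-* _ _) ⟩
    ι (FF.inv t t≉0 F.* t)           ≈⟨ ι-cong (FF.inv-inverseˡ t t≉0) ⟩
    ι F.1#                           ≈⟨ ι-1# ⟩
    1#                               ∎)
    where
    w = proj₁ ∃Tr≉0
    t = tr w
    t≉0 : ¬ (t F.≈ F.0#)
    t≉0 t≈0 = proj₂ ∃Tr≉0 (trans (sym (ι-tr w)) (trans (ι-cong t≈0) ι-0#))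

  ι-*-⟨,⟩ : ∀ e a b → ι e * ⟨ a , b ⟩ ≈ ⟨ e F.* a , e F.* b ⟩
  ι-*-⟨,⟩ e a b = begin
    ι e * (ι a + ι b * θ)           ≈⟨ solve 4 (λ e a b t → e :* (a :+ b :* t) := e :* a :+ (e :* b) :* t) refl (ι e) (ι a) (ι b) θ ⟩
    ι e * ι a + (ι e * ι b) * θ     ≈⟨ +-cong (sym (ι-* e a)) (*-congʳ (sym (ι-* e b))) ⟩
    ⟨ e F.* a , e F.* b ⟩           ∎

  ι≈⟨a,b⟩⇒b≈0 : ∀ {w a b} → ι w ≈ ⟨ a , b ⟩ → b F.≈ F.0#
  ι≈⟨a,b⟩⇒b≈0 {w} e = F.sym (proj₂ (⟨,⟩-injective (trans (⟨a,0⟩≈ιa {w} F.refl) e)))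

  φ-fixed⇒b≈0 : ∀ {a b} → φ ⟨ a , b ⟩ ≈ ⟨ a , b ⟩ → b F.≈ F.0#
  φ-fixed⇒b≈0 {a} {b} fixed = ι≈⟨a,b⟩⇒b≈0 (proj₂ (φ-fixed⇒ι ⟨ a , b ⟩ fixed))

  ⟨a,b⟩≉0 : ∀ {a b} → ¬ (b F.≈ F.0#) → ⟨ a , b ⟩ ≉ 0#
  ⟨a,b⟩≉0 b≉0 ⟨a,b⟩≈0 = b≉0 (ι≈⟨a,b⟩⇒b≈0 (trans ι-0# (sym ⟨a,b⟩≈0)))

  L≈β*Tr[γ*_] : ∀ {α₁ α₀ β γ} → α₁ ≈ β * φ γ → α₀ ≈ β * γ → ∀ x → linEval F E ι q α₁ α₀ x ≈ β * Tr (γ * x)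
  L≈β*Tr[γ*_] {α₁} {α₀} {β} {γ} α₁≈βφγ α₀≈βγ x = begin
    α₁ * φ x + α₀ * x            ≈⟨ +-cong (*-congʳ α₁≈βφγ) (*-congʳ α₀≈βγ) ⟩
    β * φ γ * φ x + β * γ * x    ≈⟨ solve 5 (λ b u v g x → b :* u :* v :+ b :* g :* x := b :* (u :* v :+ g :* x)) refl β (φ γ) (φ x) γ x ⟩
    β * (φ γ * φ x + γ * x)      ≈⟨ *-congˡ (+-congʳ (sym (φ-* γ x))) ⟩
    β * Tr (γ * x)               ∎

  -- Tr z = 0 means φ z = - z, and then Tr (γ z) = (γ - φ γ) z.
  Tr-kernel : ∀ {γ z} → φ γ ≉ γ → Tr z ≈ 0# → Tr (γ * z) ≈ 0# → z ≈ 0#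
  Tr-kernel {γ} {z} φγ≉γ Trz≈0 Trγz≈0 = x*y≈0⇒y≈0 γ-φγ≉0 (begin
    (γ - φ γ) * z          ≈⟨ solve 3 (λ g u z → (g :- u) :* z := u :* (:- z) :+ g :* z) refl γ (φ γ) z ⟩
    φ γ * (- z) + γ * z    ≈⟨ +-congʳ (*-congˡ (sym φz≈-z)) ⟩
    φ γ * φ z + γ * z      ≈⟨ +-congʳ (sym (φ-* γ z)) ⟩
    Tr (γ * z)             ≈⟨ Trγz≈0 ⟩
    0#                     ∎)
    where
    γ-φγ≉0 : γ - φ γ ≉ 0#
    γ-φγ≉0 e = φγ≉γ (sym (x-y≈0⇒x≈y e))
    φz≈-z : φ z ≈ - z
    φz≈-z = trans (solve 2 (λ a z → a := (a :+ z) :- z) refl (φ z) z) (trans (+-congʳ Trz≈0) (+-identityˡ _))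

  Tr×Tr[γ*]-injective : ∀ {γ x y} → φ γ ≉ γ → Tr x ≈ Tr y → Tr (γ * x) ≈ Tr (γ * y) → x ≈ y
  Tr×Tr[γ*]-injective {γ} {x} {y} φγ≉γ Trx≈Try Trγx≈Trγy = x-y≈0⇒x≈y (Tr-kernel φγ≉γ
    (trans (Tr-- x y) (x≈y⇒x-y≈0 Trx≈Try))
    (trans (Tr-cong (solve 3 (λ g x y → g :* (x :- y) := g :* x :- g :* y) refl γ x y))
      (trans (Tr-- (γ * x) (γ * y)) (x≈y⇒x-y≈0 Trγx≈Trγy))))

  φ-ratio⇒ι-multiple : ∀ {γ γ′} → γ′ ≉ 0# → φ γ * γ′ ≈ φ γ′ * γ → ∃ λ e → γ ≈ ι e * γ′
  φ-ratio⇒ι-multiple {γ} {γ′} γ′≉0 cross = proj₁ v∈ι , (begin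
    γ                   ≈⟨ sym (trans (*-assoc γ γ′⁻¹ γ′) (trans (*-congˡ (inv-inverseˡ γ′ γ′≉0)) (*-identityʳ γ))) ⟩
    v * γ′              ≈⟨ *-congʳ (sym (proj₂ v∈ι)) ⟩
    ι (proj₁ v∈ι) * γ′  ∎)
    where
    γ′⁻¹ = inv γ′ γ′≉0
    v = γ * γ′⁻¹
    φv≈v : φ v ≈ v
    φv≈v = *-cancelʳ (*-≉0 γ′≉0 (φ-≉0 γ′≉0)) (begin
      φ v * (γ′ * φ γ′)                ≈⟨ *-congʳ (φ-* γ γ′⁻¹) ⟩
      (φ γ * φ γ′⁻¹) * (γ′ * φ γ′)     ≈⟨ solve 4 (λ u a g′ u′ → (u :* a) :* (g′ :* u′) := (u :* g′) :* (u′ :* a)) refl (φ γ) (φ γ′⁻¹) γ′ (φ γ′) ⟩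
      (φ γ * γ′) * (φ γ′ * φ γ′⁻¹)     ≈⟨ *-cong cross (trans (sym (φ-* γ′ γ′⁻¹)) (trans (φ-cong (inv-inverseʳ γ′ γ′≉0)) φ-1#)) ⟩
      (φ γ′ * γ) * 1#                  ≈⟨ *-congˡ (sym (inv-inverseˡ γ′ γ′≉0)) ⟩
      (φ γ′ * γ) * (γ′⁻¹ * γ′)         ≈⟨ solve 4 (λ u′ g a g′ → (u′ :* g) :* (a :* g′) := (g :* a) :* (g′ :* u′)) refl (φ γ′) γ γ′⁻¹ γ′ ⟩
      v * (γ′ * φ γ′)                  ∎)
    v∈ι : ∃ λ e → ι e ≈ v
    v∈ι = φ-fixed⇒ι v φv≈v

  module _ {u c d u′ c′ d′ : F.Carrier} (d≉0 : ¬ (d F.≈ F.0#)) (d′≉0 : ¬ (d′ F.≈ F.0#))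
           (α₁≈α₁′ : ⟨ c , d ⟩ * φ ⟨ u , F.1# ⟩ ≈ ⟨ c′ , d′ ⟩ * φ ⟨ u′ , F.1# ⟩)
           (α₀≈α₀′ : ⟨ c , d ⟩ * ⟨ u , F.1# ⟩ ≈ ⟨ c′ , d′ ⟩ * ⟨ u′ , F.1# ⟩) where
    private
      γ = ⟨ u , F.1# ⟩
      γ′ = ⟨ u′ , F.1# ⟩
      β = ⟨ c , d ⟩
      β′ = ⟨ c′ , d′ ⟩
      cross : φ γ * γ′ ≈ φ γ′ * γ
      cross = *-cancelˡ (*-≉0 (⟨a,b⟩≉0 d≉0) (⟨a,b⟩≉0 d′≉0)) (begin
        (β * β′) * (φ γ * γ′)  ≈⟨ solve 4 (λ b b′ u g′ → (b :* b′) :* (u :* g′) := (b :* u) :* (b′ :* g′)) refl β β′ (φ γ) γ′ ⟩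
        (β * φ γ) * (β′ * γ′)  ≈⟨ *-cong α₁≈α₁′ (sym α₀≈α₀′) ⟩
        (β′ * φ γ′) * (β * γ)  ≈⟨ solve 4 (λ b b′ u g → (b′ :* u) :* (b :* g) := (b :* b′) :* (u :* g)) refl β β′ (φ γ′) γ ⟩
        (β * β′) * (φ γ′ * γ)  ∎)
      multiple : ∃ λ e → γ ≈ ι e * γ′
      multiple = φ-ratio⇒ι-multiple (⟨a,b⟩≉0 F.1≉0) cross
      e = proj₁ multiple
      u≈eu′×1≈e1 : u F.≈ e F.* u′ × F.1# F.≈ e F.* F.1#
      u≈eu′×1≈e1 = ⟨,⟩-injective (trans (proj₂ multiple) (ι-*-⟨,⟩ e u′ F.1#))
      e≈1 : e F.≈ F.1#
      e≈1 = F.sym (F.trans (proj₂ u≈eu′×1≈e1) (F.*-identityʳ e))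
      γ≈γ′ : γ ≈ γ′
      γ≈γ′ = trans (proj₂ multiple) (trans (*-congʳ (trans (ι-cong e≈1) ι-1#)) (*-identityˡ γ′))
      β≈β′ : β ≈ β′
      β≈β′ = *-cancelʳ (⟨a,b⟩≉0 F.1≉0) (trans α₀≈α₀′ (*-congˡ (sym γ≈γ′)))

    coefficients-injective : u F.≈ u′ × c F.≈ c′ × d F.≈ d′
    coefficients-injective = F.trans (proj₁ u≈eu′×1≈e1) (F.trans (F.*-congʳ e≈1) (F.*-identityˡ u′))
                           , ⟨,⟩-injective β≈β′

  -- Write γ = b′ ⟨u , 1⟩ and absorb the scalar b′ ∈ F into β.
  normalForm : ∀ {β γ} → φ γ ≉ γ → (∀ e → ι e ≉ β) →
    ∃ λ u → ∃ λ c → ∃ λ d → ¬ (d F.≈ F.0#)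
      × β * φ γ ≈ ⟨ c , d ⟩ * φ ⟨ u , F.1# ⟩ × β * γ ≈ ⟨ c , d ⟩ * ⟨ u , F.1# ⟩
  normalForm {β} {γ} φγ≉γ β∉ι = u , c , d , d≉0 , (begin
      β * φ γ                            ≈⟨ *-congˡ (φ-cong γ≈b′γ₀) ⟩
      β * φ (ι b′ * γ₀)                  ≈⟨ *-congˡ (trans (φ-* _ _) (*-congʳ (φ-ι b′))) ⟩
      β * (ι b′ * φ γ₀)                  ≈⟨ sym (*-assoc _ _ _) ⟩
      (β * ι b′) * φ γ₀                  ≈⟨ *-congʳ βb′≈⟨c,d⟩ ⟩
      ⟨ c , d ⟩ * φ γ₀                   ∎)
    , (begin
      β * γ                              ≈⟨ *-congˡ γ≈b′γ₀ ⟩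
      β * (ι b′ * γ₀)                    ≈⟨ sym (*-assoc _ _ _) ⟩
      (β * ι b′) * γ₀                    ≈⟨ *-congʳ βb′≈⟨c,d⟩ ⟩
      ⟨ c , d ⟩ * γ₀                     ∎)
    where
    a′ = proj₁ (coordinates γ)
    b′ = proj₁ (proj₂ (coordinates γ))
    ⟨a′,b′⟩≈γ : ⟨ a′ , b′ ⟩ ≈ γ
    ⟨a′,b′⟩≈γ = proj₂ (proj₂ (coordinates γ))
    b′≉0 : ¬ (b′ F.≈ F.0#)
    b′≉0 b′≈0 = φγ≉γ (ι≈⇒φ-fixed (trans (sym (⟨a,0⟩≈ιa b′≈0)) ⟨a′,b′⟩≈γ))
    u = FF.inv b′ b′≉0 F.* a′
    γ₀ = ⟨ u , F.1# ⟩
    γ≈b′γ₀ : γ ≈ ι b′ * γ₀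
    γ≈b′γ₀ = sym (trans (ι-*-⟨,⟩ b′ u F.1#) (trans (⟨,⟩-cong b′u≈a′ (F.*-identityʳ b′)) ⟨a′,b′⟩≈γ))
      where
      b′u≈a′ : b′ F.* u F.≈ a′
      b′u≈a′ = F.trans (F.sym (F.*-assoc _ _ _)) (F.trans (F.*-congʳ (FF.inv-inverseʳ b′ b′≉0)) (F.*-identityˡ a′))
    c = proj₁ (coordinates (β * ι b′))
    d = proj₁ (proj₂ (coordinates (β * ι b′)))
    βb′≈⟨c,d⟩ : β * ι b′ ≈ ⟨ c , d ⟩
    βb′≈⟨c,d⟩ = sym (proj₂ (proj₂ (coordinates (β * ι b′))))
    d≉0 : ¬ (d F.≈ F.0#)
    d≉0 d≈0 = β∉ι _ (ι-divide b′≉0 (trans (*-comm _ _) (trans βb′≈⟨c,d⟩ (⟨a,0⟩≈ιa d≈0))))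

  module PermutationCount (m : ℕ) (a : ℕ → F.Carrier) (g-permutation : IsPermutation F (evalG F m a)) where
    g : F.Carrier → F.Carrier
    g = evalG F m a

    G : Carrier → Carrier
    G = evalG E m (ι ∘ a)

    G-cong : ∀ {x y} → x ≈ y → G x ≈ G y
    G-cong = evalG-cong m (ι ∘ a)

    L : Carrier → Carrier → Carrier → Carrier
    L = linEval F E ι q

    f : Carrier → Carrier → Carrier → Carrier
    f α₁ α₀ x = G (Tr x) + L α₁ α₀ x

    Good : Carrier → Carrier → Set
    Good α₁ α₀ = HasRank F E ι (L α₁ α₀) 1 × IsPermutation E (f α₁ α₀)

    -- For L x = β Tr (γ x) one has f x = ⟨ g s + c t , d t ⟩ with s = Tr x, t = Tr (γ x).
    module Construction (u c d : F.Carrier) (d≉0 : ¬ (d F.≈ F.0#)) where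
      γ β α₁ α₀ : Carrier
      γ = ⟨ u , F.1# ⟩
      β = ⟨ c , d ⟩
      α₁ = β * φ γ
      α₀ = β * γ

      φγ≉γ : φ γ ≉ γ
      φγ≉γ φγ≈γ = F.1≉0 (φ-fixed⇒b≈0 φγ≈γ)

      L-form : ∀ x → L α₁ α₀ x ≈ β * Tr (γ * x)
      L-form = L≈β*Tr[γ*_] refl refl

      rank1 : HasRank F E ι (L α₁ α₀) 1
      rank1 = (λ _ → β) , β∈image , spanned , independent
        where
        γ≉0 = ⟨a,b⟩≉0 {u} F.1≉0
        w = proj₁ ∃Tr≈1
        β∈image : ∀ j → ∃ λ x → L α₁ α₀ x ≈ β
        β∈image _ = inv γ γ≉0 * w , (begin
          L α₁ α₀ (inv γ γ≉0 * w)       ≈⟨ L-form _ ⟩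
          β * Tr (γ * (inv γ γ≉0 * w))  ≈⟨ *-congˡ (Tr-cong (trans (sym (*-assoc _ _ _)) (trans (*-congʳ (inv-inverseʳ γ γ≉0)) (*-identityˡ w)))) ⟩
          β * Tr w                      ≈⟨ *-congˡ (proj₂ ∃Tr≈1) ⟩
          β * 1#                        ≈⟨ *-identityʳ β ⟩
          β                             ∎)
        spanned : ∀ x → ∃ λ (cs : Fin 1 → F.Carrier) → L α₁ α₀ x ≈ sumFin E 1 (λ j → ι (cs j) * β)
        spanned x = (λ _ → tr (γ * x)) , (begin
          L α₁ α₀ x                     ≈⟨ L-form x ⟩
          β * Tr (γ * x)                ≈⟨ *-congˡ (sym (ι-tr (γ * x))) ⟩
          β * ι (tr (γ * x))            ≈⟨ trans (*-comm β _) (sym (+-identityʳ _)) ⟩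
          ι (tr (γ * x)) * β + 0#       ∎)
        independent : ∀ (cs : Fin 1 → F.Carrier) → sumFin E 1 (λ j → ι (cs j) * β) ≈ 0# → ∀ j → cs j F.≈ F.0#
        independent cs e Fin.zero = ι-injective (trans (x*y≈0⇒y≈0 (⟨a,b⟩≉0 d≉0)
          (trans (*-comm β _) (trans (sym (+-identityʳ _)) e))) (sym ι-0#))

      f-coordinates : ∀ x → f α₁ α₀ x ≈ ⟨ g (tr x) F.+ c F.* tr (γ * x) , d F.* tr (γ * x) ⟩
      f-coordinates x = begin
        G (Tr x) + L α₁ α₀ x                      ≈⟨ +-cong (G-cong (sym (ι-tr x))) (L-form x) ⟩
        G (ι s) + β * Tr (γ * x)                  ≈⟨ +-cong (sym (ι-evalG m a s)) (*-congˡ (sym (ι-tr (γ * x)))) ⟩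
        ι (g s) + (ι c + ι d * θ) * ι t           ≈⟨ solve 5 (λ G C D H U → G :+ (C :+ D :* H) :* U := (G :+ C :* U) :+ (D :* U) :* H) refl (ι (g s)) (ι c) (ι d) θ (ι t) ⟩
        (ι (g s) + ι c * ι t) + (ι d * ι t) * θ   ≈⟨ +-cong (trans (+-congˡ (sym (ι-* c t))) (sym (ι-+ _ _))) (*-congʳ (sym (ι-* d t))) ⟩
        ⟨ g s F.+ c F.* t , d F.* t ⟩             ∎
        where
        s = tr x
        t = tr (γ * x)

      f-injective : ∀ x y → f α₁ α₀ x ≈ f α₁ α₀ y → x ≈ y
      f-injective x y fx≈fy = Tr×Tr[γ*]-injective φγ≉γ (tr≈⇒Tr≈ s≈s′) (tr≈⇒Tr≈ t≈t′)
        where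
        same : g (tr x) F.+ c F.* tr (γ * x) F.≈ g (tr y) F.+ c F.* tr (γ * y) × d F.* tr (γ * x) F.≈ d F.* tr (γ * y)
        same = ⟨,⟩-injective (trans (sym (f-coordinates x)) (trans fx≈fy (f-coordinates y)))
        t≈t′ : tr (γ * x) F.≈ tr (γ * y)
        t≈t′ = FF.*-cancelˡ d≉0 (proj₂ same)
        s≈s′ : tr x F.≈ tr y
        s≈s′ = proj₁ g-permutation _ _ (FF.+-cancelʳ (proj₁ same) (F.*-congˡ t≈t′))

      good : Good α₁ α₀
      good = rank1 , f-injective , Fq².injective⇒surjective (f α₁ α₀) f-injective

    L-- : ∀ α₁ α₀ x y → L α₁ α₀ (x - y) ≈ L α₁ α₀ x - L α₁ α₀ y
    L-- α₁ α₀ x y = trans (+-congʳ (*-congˡ (φ-- x y)))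
      (solve 6 (λ a b u v x y → a :* (u :- v) :+ b :* (x :- y) := (a :* u :+ b :* x) :- (a :* v :+ b :* y)) refl α₁ α₀ (φ x) (φ y) x y)

    -- Rank one maps the q² elements of E to q multiples of one vector, so two of them collide.
    rank1⇒kernel : ∀ {α₁ α₀} → HasRank F E ι (L α₁ α₀) 1 → ∃ λ w → w ≉ 0# × L α₁ α₀ w ≈ 0#
    rank1⇒kernel {α₁} {α₀} (b , _ , spanned , _) = w , w≉0 , (begin
      L α₁ α₀ (x - y)                                    ≈⟨ L-- α₁ α₀ x y ⟩
      L α₁ α₀ x - L α₁ α₀ y                              ≈⟨ +-cong (proj₂ (spanned x)) (-‿cong (proj₂ (spanned y))) ⟩
      (ι (coefficient x) * b₀ + 0#) - (ι (coefficient y) * b₀ + 0#) ≈⟨ +-congʳ (+-congʳ (*-congʳ (ι-cong same-coefficient))) ⟩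
      (ι (coefficient y) * b₀ + 0#) - (ι (coefficient y) * b₀ + 0#) ≈⟨ -‿inverseʳ _ ⟩
      0#                                                 ∎)
      where
      b₀ = b Fin.zero
      coefficient : Carrier → F.Carrier
      coefficient x = proj₁ (spanned x) Fin.zero
      collision : ∃₂ λ i j → i Fin.< j × Fq.index (coefficient (Fq².element i)) ≡ Fq.index (coefficient (Fq².element j))
      collision = FinP.pigeonhole q<q*q (λ j → Fq.index (coefficient (Fq².element j)))
      i = proj₁ collision
      j = proj₁ (proj₂ collision)
      x = Fq².element i
      y = Fq².element j
      w = x - y
      w≉0 : w ≉ 0#
      w≉0 w≈0 = ℕP.<-irrefl (≡.cong Fin.toℕ (Fq².element-injective i j (x-y≈0⇒x≈y w≈0))) (proj₁ (proj₂ (proj₂ collision)))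
      same-coefficient : coefficient x F.≈ coefficient y
      same-coefficient = Fq.index-injective (proj₂ (proj₂ (proj₂ collision)))

    module Classification {α₁ α₀ : Carrier} (good : Good α₁ α₀) where
      f-injective : ∀ x y → f α₁ α₀ x ≈ f α₁ α₀ y → x ≈ y
      f-injective = proj₁ (proj₂ good)

      f-surjective : ∀ y → ∃ λ x → f α₁ α₀ x ≈ y
      f-surjective = proj₂ (proj₂ good)

      kernel : ∃ λ w → w ≉ 0# × L α₁ α₀ w ≈ 0#
      kernel = rank1⇒kernel (proj₁ good)

      w : Carrier
      w = proj₁ kernel

      w≉0 : w ≉ 0#
      w≉0 = proj₁ (proj₂ kernel)

      Lw≈0 : α₁ * φ w + α₀ * w ≈ 0#
      Lw≈0 = proj₂ (proj₂ kernel)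

      -- Otherwise L η = α₀ Tr η = 0, so f η = f 0.
      α₁≉α₀ : α₁ ≉ α₀
      α₁≉α₀ α₁≈α₀ = η≉0 (f-injective η 0# (trans (+-cong (G-cong Tr-η) Lη≈0) (sym f0)))
        where
        Lη≈0 : L α₁ α₀ η ≈ 0#
        Lη≈0 = begin
          α₁ * φ η + α₀ * η   ≈⟨ +-congʳ (*-congʳ α₁≈α₀) ⟩
          α₀ * φ η + α₀ * η   ≈⟨ sym (distribˡ α₀ (φ η) η) ⟩
          α₀ * Tr η           ≈⟨ *-congˡ Tr-η ⟩
          α₀ * 0#             ≈⟨ zeroʳ α₀ ⟩
          0#                  ∎
        f0 : f α₁ α₀ 0# ≈ G 0# + 0#
        f0 = +-cong (G-cong Tr-0#) (trans (+-cong (trans (*-congˡ φ-0#) (zeroʳ _)) (zeroʳ _)) (+-identityʳ 0#))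

      -- γ = η / w turns α₁ φ w = - α₀ w into α₀ φ γ = α₁ γ.
      γ : Carrier
      γ = η * inv w w≉0

      γ≉0 : γ ≉ 0#
      γ≉0 = *-≉0 η≉0 (inv-≉0 w w≉0)

      α₀φγ≈α₁γ : α₀ * φ γ ≈ α₁ * γ
      α₀φγ≈α₁γ = sym (begin
        α₁ * (η * A)                   ≈⟨ sym (trans (*-congˡ φw*B≈1) (*-identityʳ _)) ⟩
        α₁ * (η * A) * (φ w * B)       ≈⟨ solve 5 (λ a e x u b → a :* (e :* x) :* (u :* b) := (a :* u) :* (e :* x :* b)) refl α₁ η A (φ w) B ⟩
        (α₁ * φ w) * (η * A * B)       ≈⟨ *-congʳ α₁φw≈-α₀w ⟩
        (- (α₀ * w)) * (η * A * B)     ≈⟨ solve 5 (λ a₀ w e x b → (:- (a₀ :* w)) :* (e :* x :* b) := (a₀ :* ((:- e) :* b)) :* (w :* x)) refl α₀ w η A B ⟩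
        (α₀ * ((- η) * B)) * (w * A)   ≈⟨ trans (*-congˡ (inv-inverseʳ w w≉0)) (*-identityʳ _) ⟩
        α₀ * ((- η) * B)               ≈⟨ *-congˡ (*-congʳ (sym φη≈-η)) ⟩
        α₀ * (φ η * B)                 ≈⟨ *-congˡ (sym (φ-* η A)) ⟩
        α₀ * φ γ                       ∎)
        where
        A = inv w w≉0
        B = φ A
        φw*B≈1 : φ w * B ≈ 1#
        φw*B≈1 = trans (sym (φ-* w A)) (trans (φ-cong (inv-inverseʳ w w≉0)) φ-1#)
        α₁φw≈-α₀w : α₁ * φ w ≈ - (α₀ * w)
        α₁φw≈-α₀w = trans (solve 2 (λ x y → x := (x :+ y) :- y) refl (α₁ * φ w) (α₀ * w)) (trans (+-congʳ Lw≈0) (+-identityˡ _))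

      β : Carrier
      β = α₀ * inv γ γ≉0

      α₁≈βφγ : α₁ ≈ β * φ γ
      α₁≈βφγ = sym (begin
        α₀ * γ⁻¹ * φ γ      ≈⟨ solve 3 (λ a i u → a :* i :* u := i :* (a :* u)) refl α₀ γ⁻¹ (φ γ) ⟩
        γ⁻¹ * (α₀ * φ γ)    ≈⟨ *-congˡ α₀φγ≈α₁γ ⟩
        γ⁻¹ * (α₁ * γ)      ≈⟨ solve 3 (λ i a g → i :* (a :* g) := a :* (i :* g)) refl γ⁻¹ α₁ γ ⟩
        α₁ * (γ⁻¹ * γ)      ≈⟨ trans (*-congˡ (inv-inverseˡ γ γ≉0)) (*-identityʳ α₁) ⟩
        α₁                  ∎)
        where γ⁻¹ = inv γ γ≉0

      α₀≈βγ : α₀ ≈ β * γ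
      α₀≈βγ = sym (trans (*-assoc α₀ _ γ) (trans (*-congˡ (inv-inverseˡ γ γ≉0)) (*-identityʳ α₀)))

      φγ≉γ : φ γ ≉ γ
      φγ≉γ φγ≈γ = α₁≉α₀ (trans α₁≈βφγ (trans (*-congˡ φγ≈γ) (sym α₀≈βγ)))

      -- If β were in F, f would take all its values in F and miss θ.
      β∉ι : ∀ e → ι e ≉ β
      β∉ι e ιe≈β = ι≉θ (g s F.+ e F.* t) (begin
        ι (g s F.+ e F.* t)           ≈⟨ trans (ι-+ _ _) (+-congˡ (ι-* e t)) ⟩
        ι (g s) + ι e * ι t           ≈⟨ +-cong (ι-evalG m a s) (*-cong ιe≈β (ι-tr (γ * x))) ⟩
        G (ι s) + β * Tr (γ * x)      ≈⟨ +-cong (G-cong (ι-tr x)) (sym (L≈β*Tr[γ*_] α₁≈βφγ α₀≈βγ x)) ⟩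
        f α₁ α₀ x                     ≈⟨ proj₂ (f-surjective θ) ⟩
        θ                             ∎)
        where
        x = proj₁ (f-surjective θ)
        s = tr x
        t = tr (γ * x)

      normal : ∃ λ u → ∃ λ c → ∃ λ d → ¬ (d F.≈ F.0#)
        × α₁ ≈ ⟨ c , d ⟩ * φ ⟨ u , F.1# ⟩ × α₀ ≈ ⟨ c , d ⟩ * ⟨ u , F.1# ⟩
      normal =
        let u , c , d , d≉0 , α₁≈ , α₀≈ = normalForm φγ≉γ β∉ι
        in u , c , d , d≉0 , trans α₁≈βφγ α₁≈ , trans α₀≈βγ α₀≈

    N : ℕ
    N = q ℕ.* q ℕ.* suc r

    u-index c-index : Fin N → Fin q
    u-index i = proj₁ (remQuot {q} q (proj₁ (remQuot {q ℕ.* q} (suc r) i)))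
    c-index i = proj₂ (remQuot {q} q (proj₁ (remQuot {q ℕ.* q} (suc r) i)))

    d-index : Fin N → Fin (suc r)
    d-index i = proj₂ (remQuot {q ℕ.* q} (suc r) i)

    indices-injective : ∀ {i j} → u-index i ≡ u-index j → c-index i ≡ c-index j → d-index i ≡ d-index j → i ≡ j
    indices-injective u≡ c≡ d≡ = remQuot-injective {q ℕ.* q} (suc r) (remQuot-injective {q} q u≡ c≡) d≡

    indices-surjective : ∀ iu ic id → ∃ λ i → u-index i ≡ iu × c-index i ≡ ic × d-index i ≡ id
    indices-surjective iu ic id = combine (combine iu ic) id , ≡.cong proj₁ inner , ≡.cong proj₂ inner , ≡.cong proj₂ outer
      where
      outer : remQuot {q ℕ.* q} (suc r) (combine (combine iu ic) id) ≡ (combine iu ic , id)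
      outer = FinP.remQuot-combine _ _
      inner : remQuot {q} q (proj₁ (remQuot {q ℕ.* q} (suc r) (combine (combine iu ic) id))) ≡ (iu , ic)
      inner = ≡.trans (≡.cong (remQuot {q} q ∘ proj₁) outer) (FinP.remQuot-combine iu ic)

    u-at c-at d-at : Fin N → F.Carrier
    u-at = Fq.element ∘ u-index
    c-at = Fq.element ∘ c-index
    d-at = Fq.nonzeroElement ∘ d-index

    parameters-surjective : ∀ u c d → ¬ (d F.≈ F.0#) → ∃ λ i → u-at i F.≈ u × c-at i F.≈ c × d-at i F.≈ d
    parameters-surjective u c d d≉0 =
      let i , u≡ , c≡ , d≡ = indices-surjective (Fq.index u) (Fq.index c) (Fq.nonzeroIndex d d≉0)
      in i , F.trans (F.reflexive (≡.cong Fq.element u≡)) (Fq.element-index u)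
           , F.trans (F.reflexive (≡.cong Fq.element c≡)) (Fq.element-index c)
           , F.trans (F.reflexive (≡.cong Fq.nonzeroElement d≡)) (Fq.nonzeroElement-nonzeroIndex d d≉0)

    module At (i : Fin N) = Construction (u-at i) (c-at i) (d-at i) (Fq.nonzeroElement-≉0 (d-index i))

    coefficients : Fin N → Carrier × Carrier
    coefficients i = At.α₁ i , At.α₀ i

    coefficients-distinct : ∀ i j → At.α₁ i ≈ At.α₁ j → At.α₀ i ≈ At.α₀ j → i ≡ j
    coefficients-distinct i j α₁≈ α₀≈ =
      let u≈ , c≈ , d≈ = coefficients-injective (Fq.nonzeroElement-≉0 _) (Fq.nonzeroElement-≉0 _) α₁≈ α₀≈
      in indices-injective (Fq.element-injective _ _ u≈) (Fq.element-injective _ _ c≈) (Fq.nonzeroElement-injective _ _ d≈)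

    coefficients-complete : ∀ α₁ α₀ → Good α₁ α₀ → ∃ λ i → At.α₁ i ≈ α₁ × At.α₀ i ≈ α₀
    coefficients-complete α₁ α₀ good =
      let u , c , d , d≉0 , α₁≈ , α₀≈ = Classification.normal good
          i , u-at≈u , c-at≈c , d-at≈d = parameters-surjective u c d d≉0
      in i , trans (*-cong (⟨,⟩-cong c-at≈c d-at≈d) (φ-cong (⟨,⟩-cong u-at≈u F.refl))) (sym α₁≈)
           , trans (*-cong (⟨,⟩-cong c-at≈c d-at≈d) (⟨,⟩-cong u-at≈u F.refl)) (sym α₀≈)

    count : CountPairs F E ι Good N
    count = coefficients , At.good , coefficients-distinct , coefficients-complete

open import Data.Nat using (_*_)

theorem9 : (q m : ℕ) → IsPrimePower q → 2 ≤ m →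
    (F E : Field) → HasSize F q → HasSize E (q * q) →
    (ι : Field.Carrier F → Field.Carrier E) → IsEmbedding F E ι →
    (a : ℕ → Field.Carrier F) →
    IsPermutation F (evalG F m a) →
    CountPairs F E ι
      (λ α₁ α₀ →
        HasRank F E ι (linEval F E ι q α₁ α₀) 1
        × IsPermutation E (λ x →
            Field._+_ E (evalG E m (ι ∘ a) (Field._+_ E (pow E x q) x))
                        (linEval F E ι q α₁ α₀ x)))
      (q * q * (q ∸ 1))
theorem9 q m (p , k , p-prime , q≡p^k) _ F E sizeF sizeE ι ι-embedding a g-permutation
  with FieldProperties.size≥2 F sizeF
... | r , ≡.refl = PermutationCount.count m a g-permutation
  where open QuadraticExtension {k = k} p-prime q≡p^k F E sizeF sizeE ι ι-embedding
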